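{- For every integer $n\ge 0$ there is a bijection between the set $\mathcal{D}^{\mathfrak{D}}(n)$ of Dyck paths of length $2n$ whose $k$-ascents are coloured by Dyck paths of length $2k$ and the set $\mathcal{NC}(n+1)$ of non-crossing trees on $[n+1]$.
   Context: A Dyck path of length $2n$ is a word in the letters $U,D$ with $n$ letters of each kind such that every prefix contains at least as many $U$'s as $D$'s; $\mathcal{D}(n)$ denotes the set of Dyck paths of length $2n$ (so $\mathcal{D}(0)$ consists of the empty path). A $k$-ascent of a Dyck path is a maximal block of $k$ consecutive letters $U$ (not preceded or followed by another $U$). A Dyck path of length $2n$ with $k$-ascents coloured by Dyck paths of length $2k$ is a Dyck path $P$ of length $2n$ together with an assignment, to each ascent of $P$, of a Dyck path of length $2k$, where $k$ is the length of that ascent; $\mathcal{D}^{\mathfrak{D}}(n)$ is the set of all such coloured paths (two coloured paths are equal iff the underlying paths and all colours agree). A non-crossing tree on $[n+1]$ is a tree with vertex set $\{1,\dots,n+1\}$ which can be drawn with the vertices placed on a circle in clockwise order $1,2,\dots,n+1$ and the edges drawn as straight segments no two of which cross (except at common endpoints); $\mathcal{NC}(n+1)$ is the set of such trees. -}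

module Defs where

open import Data.Nat using (ℕ; zero; suc; _≤_; _+_)
open import Data.List using (List; []; _∷_; take; length)
open import Data.List.Relation.Unary.All using (All)
open import Data.List.Relation.Unary.Unique.Propositional using (Unique)
open import Data.Fin using (Fin; _<_)
open import Data.Vec using (Vec; lookup)
open import Data.Bool using (Bool; true; false)
open import Data.Product using (_×_; ∃-syntax)
open import Relation.Binary.PropositionalEquality using (_≡_)
open import Relation.Nullary using (¬_)

data Step : Set where
  U D : Step

countU : List Step → ℕ
countU []      = 0
countU (U ∷ w) = suc (countU w)
countU (D ∷ w) = countU w

countD : List Step → ℕ
countD []      = 0
countD (U ∷ w) = countD w
countD (D ∷ w) = suc (countD w)

record IsDyck (n : ℕ) (w : List Step) : Set where
  field
    #U      : countU w ≡ n
    #D      : countD w ≡ n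
    prefixes : ∀ k → countD (take k w) ≤ countU (take k w)

-- 𝒟(n).  The proof field is irrelevant, so two Dyck paths are equal
-- iff their words are equal.
record DyckPath (n : ℕ) : Set where
  constructor dyck
  field
    word      : List Step
    .isDyck   : IsDyck n word
open DyckPath public

-- Lengths of the maximal blocks of consecutive U's (the ascents), in order
-- from left to right.
ascentsFrom : ℕ → List Step → List ℕ
ascentsFrom zero    []      = []
ascentsFrom (suc k) []      = suc k ∷ []
ascentsFrom k       (U ∷ w) = ascentsFrom (suc k) w
ascentsFrom zero    (D ∷ w) = ascentsFrom zero w
ascentsFrom (suc k) (D ∷ w) = suc k ∷ ascentsFrom zero w

ascents : List Step → List ℕ
ascents = ascentsFrom zero

record ColouredDyckPath (n : ℕ) : Set where
  constructor coloured
  field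
    path    : DyckPath n
    colours : All DyckPath (ascents (word path))

-- Non-crossing trees on m vertices, labelled 0,…,m-1 (= 1,…,m shifted)
-- in clockwise order on a circle.

Adj : ∀ {m} → Vec (Vec Bool m) m → Fin m → Fin m → Set
Adj M i j = lookup (lookup M i) j ≡ true

data Walk {m} (M : Vec (Vec Bool m) m) : Fin m → Fin m → Set where
  here : ∀ {i} → Walk M i i
  step : ∀ {i j k} → Adj M i j → Walk M j k → Walk M i k

CycleEdges : ∀ {m} → Vec (Vec Bool m) m → Fin m → Fin m → List (Fin m) → Set
CycleEdges M v u []       = Adj M u v
CycleEdges M v u (x ∷ xs) = Adj M u x × CycleEdges M v x xs

HasCycle : ∀ {m} → Vec (Vec Bool m) m → Set
HasCycle {m} M = ∃[ v ] ∃[ vs ]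
  (3 ≤ length (v ∷ vs) × Unique (v ∷ vs) × CycleEdges M v v vs)

record IsNCTree (m : ℕ) (M : Vec (Vec Bool m) m) : Set where
  field
    symmetric   : ∀ i j → Adj M i j → Adj M j i
    loopless    : ∀ i → ¬ Adj M i i
    connected   : ∀ i j → Walk M i j
    acyclic     : ¬ HasCycle M
    noncrossing : ∀ a b c d → Adj M a b → Adj M c d → a < b → c < d →
                  ¬ (a < c × c < b × b < d)

-- 𝒩𝒞(m): non-crossing trees on m vertices; equal iff same edge set.
record NCTree (m : ℕ) : Set where
  constructor nctree
  field
    adjacency : Vec (Vec Bool m) m
    .isNCTree : IsNCTree m adjacency

-- Both sets are in bijection with ternary trees with n nodes.
--
-- A ternary tree node a b c is drawn on consecutive vertices l, …, r of the circle: a and b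
-- side by side under an edge from l to a vertex k, and c hanging from k.  This gives a
-- noncrossing tree, and every noncrossing tree arises exactly once: k is forced to be the
-- largest neighbour of l, the edge l – k separates [l, k] from [k, r], and [l, k] without
-- that edge splits again at the largest neighbour of l below k.  The decoder follows this
-- interval recursion; that it recovers the tree uses connectivity on each interval,
-- noncrossing to keep edges inside intervals, and acyclicity to rule out an edge c – r.
--
-- A ternary tree is also a binary tree (its spine) whose nodes carry ternary trees.  A
-- coloured Dyck path splits at its first ascent as U^k D P₁ ⋯ D P_k; the colour of that
-- ascent, a Dyck path of length 2k, is a spine with k nodes, and P₁, …, P_k are the trees
-- it carries.

module Submission where

open import Data.Nat
open import Data.Nat.Properties
open import Data.Nat.Tactic.RingSolver
open import Data.Bool using (Bool; true; false; _∨_; _∧_; T; if_then_else_)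
open import Data.Bool.Properties using (∨-identityʳ; ∨-zeroʳ; ∧-zeroʳ; T-≡) renaming (_≟_ to _≟B_)
open import Data.Maybe using (Maybe; just; nothing; fromMaybe)
open import Data.Product hiding (map)
open import Data.Sum as Sum hiding (map)
open import Data.Empty
open import Data.Unit using (⊤; tt)
open import Data.Fin as F using (Fin; toℕ; fromℕ<)
open import Data.Fin.Properties using (toℕ-injective; toℕ<n; fromℕ<-toℕ; toℕ-fromℕ<)
open import Data.Vec using (Vec; lookup; tabulate)
open import Data.Vec.Properties using (lookup∘tabulate; tabulate∘lookup; tabulate-cong; ≡-dec)
open import Data.List using (List; []; _∷_; _++_; take; length; replicate; map)
open import Data.List.Properties using (++-assoc; ++-identityʳ; ∷-injectiveˡ; ∷-injectiveʳ; length-++; length-map)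
open import Data.List.Relation.Unary.All as All using (All; []; _∷_)
open import Data.List.Relation.Unary.Any using (here)
open import Data.List.Relation.Unary.AllPairs as AP using (AllPairs; []; _∷_)
open import Data.List.Relation.Unary.Unique.Propositional using (Unique)
import Data.List.Relation.Unary.Unique.Propositional.Properties as UP
open import Data.List.Membership.Propositional using (_∈_)
open import Data.List.Membership.DecPropositional _≟_ using (_∈?_)
open import Data.List.Membership.Propositional.Properties using (∈-∃++; ∈-++⁺ʳ)
open import Relation.Binary.PropositionalEquality
open import Relation.Nullary
open import Relation.Nullary.Decidable using (recompute; map′)
open import Function.Base using (id; _∘_; flip; case_of_)
open import Function.Bundles using (_↔_; mk↔ₛ′; _⤖_; Equivalence)
open import Function.Properties.Inverse using (↔⇒⤖; ↔-trans)
open import Defs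
open IsNCTree

true≢false : true ≢ false
true≢false ()

∨-true⁻ : ∀ {a b} → a ∨ b ≡ true → a ≡ true ⊎ b ≡ true
∨-true⁻ {true} e = inj₁ refl
∨-true⁻ {false} e = inj₂ e

∨-trueˡ : ∀ {a} b → a ≡ true → a ∨ b ≡ true
∨-trueˡ b refl = refl

∨-trueʳ : ∀ a {b} → b ≡ true → a ∨ b ≡ true
∨-trueʳ a refl = ∨-zeroʳ a

∧-true⁻ : ∀ {a b} → a ∧ b ≡ true → a ≡ true × b ≡ true
∧-true⁻ {true} e = refl , e

¬true⇒false : ∀ {a} → ¬ (a ≡ true) → a ≡ false
¬true⇒false {true} h = ⊥-elim (h refl)
¬true⇒false {false} h = refl

true⇔true⇒≡ : ∀ {a b} → (a ≡ true → b ≡ true) → (b ≡ true → a ≡ true) → a ≡ b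
true⇔true⇒≡ {true} {b} f g = sym (f refl)
true⇔true⇒≡ {false} {true} f g = g refl
true⇔true⇒≡ {false} {false} f g = refl

≡ᵇ-true⇒≡ : ∀ m n → (m ≡ᵇ n) ≡ true → m ≡ n
≡ᵇ-true⇒≡ m n e = ≡ᵇ⇒≡ m n (Equivalence.from T-≡ e)

≡ᵇ-refl : ∀ n → (n ≡ᵇ n) ≡ true
≡ᵇ-refl n = Equivalence.to T-≡ (≡⇒≡ᵇ n n refl)

<ᵇ-true⇒< : ∀ m n → (m <ᵇ n) ≡ true → m < n
<ᵇ-true⇒< m n e = <ᵇ⇒< m n (Equivalence.from T-≡ e)

<⇒<ᵇ-true : ∀ {m n} → m < n → (m <ᵇ n) ≡ true
<⇒<ᵇ-true m<n = Equivalence.to T-≡ (<⇒<ᵇ m<n)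

<ᵇ-false⇒≥ : ∀ m n → (m <ᵇ n) ≡ false → n ≤ m
<ᵇ-false⇒≥ m n e = ≮⇒≥ λ m<n → subst T e (<⇒<ᵇ m<n)

≥⇒<ᵇ-false : ∀ {m n} → n ≤ m → (m <ᵇ n) ≡ false
≥⇒<ᵇ-false {m} {n} n≤m = ¬true⇒false λ e → <⇒≱ (<ᵇ-true⇒< m n e) n≤m

edge : ℕ → ℕ → ℕ → ℕ → Bool
edge l k x y = ((x ≡ᵇ l) ∧ (y ≡ᵇ k)) ∨ ((x ≡ᵇ k) ∧ (y ≡ᵇ l))

edge-true : ∀ l k x y → edge l k x y ≡ true → (x ≡ l × y ≡ k) ⊎ (x ≡ k × y ≡ l)
edge-true l k x y e with ∨-true⁻ {(x ≡ᵇ l) ∧ (y ≡ᵇ k)} e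
... | inj₁ e₁ = let (p , q) = ∧-true⁻ e₁ in inj₁ (≡ᵇ-true⇒≡ _ _ p , ≡ᵇ-true⇒≡ _ _ q)
... | inj₂ e₂ = let (p , q) = ∧-true⁻ e₂ in inj₂ (≡ᵇ-true⇒≡ _ _ p , ≡ᵇ-true⇒≡ _ _ q)

edge-forward : ∀ l k → edge l k l k ≡ true
edge-forward l k rewrite ≡ᵇ-refl l | ≡ᵇ-refl k = refl

edge-backward : ∀ l k → edge l k k l ≡ true
edge-backward l k rewrite ≡ᵇ-refl l | ≡ᵇ-refl k = ∨-zeroʳ ((k ≡ᵇ l) ∧ (l ≡ᵇ k))

edge-converse : ∀ {l k x y} → edge l k x y ≡ true → edge x y l k ≡ true
edge-converse {l} {k} {x} {y} e with edge-true l k x y e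
... | inj₁ (refl , refl) = edge-forward x y
... | inj₂ (refl , refl) = edge-backward x y

edge-false : ∀ l k x y → ¬ (x ≡ l × y ≡ k) → ¬ (x ≡ k × y ≡ l) → edge l k x y ≡ false
edge-false l k x y ¬fwd ¬bwd = ¬true⇒false λ e → [ ¬fwd , ¬bwd ]′ (edge-true l k x y e)

-- Ternary trees drawn as noncrossing trees

data Ternary : Set where
  leaf : Ternary
  node : Ternary → Ternary → Ternary → Ternary

-- node a b c is drawn on the consecutive vertices l, …, end (node a b c) l: the subtree a on
-- [l, p], b on [p + 1, k] and c on [k, end c k], where p = end a l and k = apex a b l,
-- together with the edge l – k.
end : Ternary → ℕ → ℕ
end leaf l = l
end (node a b c) l = end c (end b (suc (end a l)))

apex : Ternary → Ternary → ℕ → ℕ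
apex a b l = end b (suc (end a l))

size : Ternary → ℕ
size leaf = 0
size (node a b c) = suc (size a + size b + size c)

end-size : ∀ t l → end t l ≡ size t + l
end-size leaf l = refl
end-size (node a b c) l
  rewrite end-size c (end b (suc (end a l))) | end-size b (suc (end a l)) | end-size a l =
  +-reassoc (size a) (size b) (size c) l
  where
  +-reassoc : ∀ a b c l → c + (b + suc (a + l)) ≡ suc (a + b + c) + l
  +-reassoc = solve-∀

≤-end : ∀ t l → l ≤ end t l
≤-end leaf l = ≤-refl
≤-end (node a b c) l = ≤-trans (≤-end a l) (≤-trans (n≤1+n _) (≤-trans (≤-end b _) (≤-end c _)))

end<apex : ∀ a b l → end a l < apex a b l
end<apex a b l = ≤-end b _

start<apex : ∀ a b l → l < apex a b l
start<apex a b l = ≤-<-trans (≤-end a l) (end<apex a b l)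

edge-false-below : ∀ {l k x y} → x < k → y < k → edge l k x y ≡ false
edge-false-below x<k y<k = edge-false _ _ _ _ (λ (_ , y≡k) → <⇒≢ y<k y≡k) (λ (x≡k , _) → <⇒≢ x<k x≡k)

edge-false-above : ∀ {l k x y} → l < x → l < y → edge l k x y ≡ false
edge-false-above l<x l<y = edge-false _ _ _ _ (λ (x≡l , _) → <⇒≢ l<x (sym x≡l)) (λ (_ , y≡l) → <⇒≢ l<y (sym y≡l))

edges : Ternary → ℕ → ℕ → ℕ → Bool
edges leaf l x y = false
edges (node a b c) l x y =
  edges a l x y ∨ (edges b (suc (end a l)) x y ∨ (edge l (apex a b l) x y ∨ edges c (apex a b l) x y))

data NodeEdge (a b c : Ternary) (l x y : ℕ) : Set where
  in-a      : edges a l x y ≡ true → NodeEdge a b c l x y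
  in-b      : edges b (suc (end a l)) x y ≡ true → NodeEdge a b c l x y
  apex-edge : edge l (apex a b l) x y ≡ true → NodeEdge a b c l x y
  in-c      : edges c (apex a b l) x y ≡ true → NodeEdge a b c l x y

node-edge : ∀ a b c l {x y} → edges (node a b c) l x y ≡ true → NodeEdge a b c l x y
node-edge a b c l {x} {y} e with ∨-true⁻ {edges a l x y} e
... | inj₁ ea = in-a ea
... | inj₂ e′ with ∨-true⁻ {edges b (suc (end a l)) x y} e′
... | inj₁ eb = in-b eb
... | inj₂ e″ with ∨-true⁻ {edge l (apex a b l) x y} e″
... | inj₁ ek = apex-edge ek
... | inj₂ ec = in-c ec

node-edge⁻ : ∀ a b c l {x y} → NodeEdge a b c l x y → edges (node a b c) l x y ≡ true
node-edge⁻ a b c l (in-a e) = ∨-trueˡ _ e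
node-edge⁻ a b c l {x} {y} (in-b e) = ∨-trueʳ (edges a l x y) (∨-trueˡ _ e)
node-edge⁻ a b c l {x} {y} (apex-edge e) = ∨-trueʳ (edges a l x y) (∨-trueʳ (edges b _ x y) (∨-trueˡ _ e))
node-edge⁻ a b c l {x} {y} (in-c e) =
  ∨-trueʳ (edges a l x y) (∨-trueʳ (edges b _ x y) (∨-trueʳ (edge l _ x y) e))

apex-edge-forward : ∀ a b c l → edges (node a b c) l l (apex a b l) ≡ true
apex-edge-forward a b c l = node-edge⁻ a b c l (apex-edge (edge-forward l _))

apex-edge-backward : ∀ a b c l → edges (node a b c) l (apex a b l) l ≡ true
apex-edge-backward a b c l = node-edge⁻ a b c l (apex-edge (edge-backward l (apex a b l)))

Between : ℕ → ℕ → ℕ → Set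
Between l r x = l ≤ x × x ≤ r

BothBetween : ℕ → ℕ → ℕ → ℕ → Set
BothBetween l r x y = Between l r x × Between l r y

BothBetween-mono : ∀ {l l′ r r′ x y} → l′ ≤ l → r ≤ r′ → BothBetween l r x y → BothBetween l′ r′ x y
BothBetween-mono p q ((a , b) , (c , d)) = (≤-trans p a , ≤-trans b q) , (≤-trans p c , ≤-trans d q)

edge-between : ∀ {l k x y} → l ≤ k → edge l k x y ≡ true → BothBetween l k x y
edge-between {l} {k} {x} {y} l≤k e with edge-true l k x y e
... | inj₁ (refl , refl) = (≤-refl , l≤k) , (l≤k , ≤-refl)
... | inj₂ (refl , refl) = (l≤k , ≤-refl) , (≤-refl , l≤k)

edges-between : ∀ t l {x y} → edges t l x y ≡ true → BothBetween l (end t l) x y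
edges-between leaf l ()
edges-between (node a b c) l e with node-edge a b c l e
... | in-a e′ = BothBetween-mono ≤-refl (≤-trans (<⇒≤ (end<apex a b l)) (≤-end c _)) (edges-between a l e′)
... | in-b e′ = BothBetween-mono (≤-trans (≤-end a l) (n≤1+n _)) (≤-end c _) (edges-between b _ e′)
... | apex-edge e′ = BothBetween-mono ≤-refl (≤-end c _) (edge-between (<⇒≤ (start<apex a b l)) e′)
... | in-c e′ = BothBetween-mono (<⇒≤ (start<apex a b l)) ≤-refl (edges-between c _ e′)

edges-sym : ∀ t l {x y} → edges t l x y ≡ true → edges t l y x ≡ true
edges-sym leaf l ()
edges-sym (node a b c) l {x} {y} e = node-edge⁻ a b c l (reverse (node-edge a b c l e))
  where
  reverse : NodeEdge a b c l x y → NodeEdge a b c l y x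
  reverse (in-a e′) = in-a (edges-sym a l e′)
  reverse (in-b e′) = in-b (edges-sym b _ e′)
  reverse (apex-edge e′) with edge-true l _ x y e′
  ... | inj₁ (refl , refl) = apex-edge (edge-backward l (apex a b l))
  ... | inj₂ (refl , refl) = apex-edge (edge-forward l (apex a b l))
  reverse (in-c e′) = in-c (edges-sym c _ e′)

edges-irreflexive : ∀ t l x → edges t l x x ≡ false
edges-irreflexive t l x = ¬true⇒false (loop t)
  where
  loop : ∀ t {l} → ¬ edges t l x x ≡ true
  loop leaf ()
  loop (node a b c) {l} e with node-edge a b c l e
  ... | in-a e′ = loop a e′
  ... | in-b e′ = loop b e′
  ... | in-c e′ = loop c e′
  ... | apex-edge e′ with edge-true l _ x x e′
  ...   | inj₁ (refl , q) = <⇒≢ (start<apex a b l) q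
  ...   | inj₂ (refl , q) = <⇒≢ (start<apex a b l) (sym q)

Graph : Set₁
Graph = ℕ → ℕ → Set

⟦_⟧ : (ℕ → ℕ → Bool) → Graph
⟦ G ⟧ x y = G x y ≡ true

Crosses : ℕ → ℕ → ℕ → ℕ → Set
Crosses a b c d = a < c × c < b × b < d

NonCrossing : Graph → Set
NonCrossing R = ∀ a b c d → R a b → R c d → a < b → c < d → ¬ Crosses a b c d

separated-¬crossesˡ : ∀ {α β γ δ a b c d} → BothBetween α β a b → BothBetween γ δ c d → β ≤ γ → ¬ Crosses a b c d
separated-¬crossesˡ (_ , (_ , b≤β)) ((γ≤c , _) , _) β≤γ (_ , c<b , _) =
  <-irrefl refl (<-≤-trans c<b (≤-trans b≤β (≤-trans β≤γ γ≤c)))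

separated-¬crossesʳ : ∀ {α β γ δ a b c d} → BothBetween α β c d → BothBetween γ δ a b → β ≤ γ → ¬ Crosses a b c d
separated-¬crossesʳ ((_ , c≤β) , _) ((γ≤a , _) , _) β≤γ (a<c , _ , _) =
  <-irrefl refl (<-≤-trans a<c (≤-trans c≤β (≤-trans β≤γ γ≤a)))

nested-¬crossesˡ : ∀ {L K a b c d} → a ≡ L → b ≡ K → BothBetween L K c d → ¬ Crosses a b c d
nested-¬crossesˡ refl refl (_ , (_ , d≤b)) (_ , _ , b<d) = <-irrefl refl (<-≤-trans b<d d≤b)

nested-¬crossesʳ : ∀ {L K a b c d} → c ≡ L → d ≡ K → BothBetween L K a b → ¬ Crosses a b c d
nested-¬crossesʳ refl refl ((c≤a , _) , _) (a<c , _ , _) = <-irrefl refl (<-≤-trans a<c c≤a)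

apex-edge-oriented : ∀ {l k x y} → l < k → x < y → edge l k x y ≡ true → x ≡ l × y ≡ k
apex-edge-oriented {l} {k} {x} {y} l<k x<y e with edge-true l k x y e
... | inj₁ p = p
... | inj₂ (refl , refl) = ⊥-elim (<-asym x<y l<k)

edges-nonCrossing : ∀ t l → NonCrossing ⟦ edges t l ⟧
edges-nonCrossing leaf l a b c d ()
edges-nonCrossing (node A B C) l a b c d e₁ e₂ a<b c<d
  with node-edge A B C l e₁ | node-edge A B C l e₂
... | in-a x | in-a y = edges-nonCrossing A l a b c d x y a<b c<d
... | in-b x | in-b y = edges-nonCrossing B _ a b c d x y a<b c<d
... | in-c x | in-c y = edges-nonCrossing C _ a b c d x y a<b c<d
... | apex-edge x | apex-edge y = λ (a<c , _) →
  <-irrefl (trans (proj₁ (apex-edge-oriented (start<apex A B l) a<b x))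
                  (sym (proj₁ (apex-edge-oriented (start<apex A B l) c<d y)))) a<c
... | in-a x | in-b y = separated-¬crossesˡ (edges-between A l x) (edges-between B _ y) (n≤1+n _)
... | in-b x | in-a y = separated-¬crossesʳ (edges-between A l y) (edges-between B _ x) (n≤1+n _)
... | in-a x | in-c y = separated-¬crossesˡ (edges-between A l x) (edges-between C _ y) (<⇒≤ (end<apex A B l))
... | in-c x | in-a y = separated-¬crossesʳ (edges-between A l y) (edges-between C _ x) (<⇒≤ (end<apex A B l))
... | in-b x | in-c y = separated-¬crossesˡ (edges-between B _ x) (edges-between C _ y) ≤-refl
... | in-c x | in-b y = separated-¬crossesʳ (edges-between B _ y) (edges-between C _ x) ≤-refl
... | in-a x | apex-edge y = uncurry nested-¬crossesʳ (apex-edge-oriented (start<apex A B l) c<d y)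
                                (BothBetween-mono ≤-refl (<⇒≤ (end<apex A B l)) (edges-between A l x))
... | apex-edge x | in-a y = uncurry nested-¬crossesˡ (apex-edge-oriented (start<apex A B l) a<b x)
                                (BothBetween-mono ≤-refl (<⇒≤ (end<apex A B l)) (edges-between A l y))
... | in-b x | apex-edge y = uncurry nested-¬crossesʳ (apex-edge-oriented (start<apex A B l) c<d y)
                                (BothBetween-mono (≤-trans (≤-end A l) (n≤1+n _)) ≤-refl (edges-between B _ x))
... | apex-edge x | in-b y = uncurry nested-¬crossesˡ (apex-edge-oriented (start<apex A B l) a<b x)
                                (BothBetween-mono (≤-trans (≤-end A l) (n≤1+n _)) ≤-refl (edges-between B _ y))
... | in-c x | apex-edge y = separated-¬crossesʳ (edge-between (<⇒≤ (start<apex A B l)) y) (edges-between C _ x) ≤-refl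
... | apex-edge x | in-c y = separated-¬crossesˡ (edge-between (<⇒≤ (start<apex A B l)) x) (edges-between C _ y) ≤-refl

data WalkIn (R : Graph) (P : ℕ → Set) : ℕ → ℕ → Set where
  here : ∀ {x} → WalkIn R P x x
  step : ∀ {x y z} → R x y → P y → WalkIn R P y z → WalkIn R P x z

_++ʷ_ : ∀ {R P x y z} → WalkIn R P x y → WalkIn R P y z → WalkIn R P x z
here ++ʷ w = w
step r p w ++ʷ w′ = step r p (w ++ʷ w′)

WalkIn-map : ∀ {R R′ : Graph} {P P′ : ℕ → Set} {x y} →
             (∀ {u v} → R u v → R′ u v) → (∀ {u} → P u → P′ u) → WalkIn R P x y → WalkIn R′ P′ x y
WalkIn-map f g here = here
WalkIn-map f g (step r p w) = step (f r) (g p) (WalkIn-map f g w)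

WalkIn-reverse : ∀ {R P x y} → (∀ {u v} → R u v → R v u) → P x → WalkIn R P x y → WalkIn R P y x
WalkIn-reverse sym-R px here = here
WalkIn-reverse sym-R px (step r py w) = WalkIn-reverse sym-R py w ++ʷ step (sym-R r) px here

WalkIn-last : ∀ {R P x y} → x ≢ y → P x → WalkIn R P x y → ∃ λ z → P z × R z y
WalkIn-last x≢y px here = ⊥-elim (x≢y refl)
WalkIn-last {y = y} x≢y px (step {y = z} r pz w) with z ≟ y
... | yes refl = _ , px , r
... | no z≢y = WalkIn-last z≢y pz w

edges-connected : ∀ t l {x} → Between l (end t l) x → WalkIn ⟦ edges t l ⟧ (λ _ → ⊤) x l
edges-connected leaf l (l≤x , x≤l) with ≤-antisym x≤l l≤x
... | refl = here
edges-connected (node a b c) l {x} (l≤x , x≤r) with x ≤? end a l | x ≤? apex a b l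
... | yes x≤p | _ = WalkIn-map (node-edge⁻ a b c l ∘ in-a) _ (edges-connected a l (l≤x , x≤p))
... | no x≰p | yes x≤k =
  WalkIn-map (node-edge⁻ a b c l ∘ in-b) _
    (edges-connected b _ (≰⇒> x≰p , x≤k) ++ʷ WalkIn-reverse (edges-sym b _) _ (edges-connected b _ (≤-end b _ , ≤-refl)))
  ++ʷ step (apex-edge-backward a b c l) _ here
... | no x≰p | no x≰k =
  WalkIn-map (node-edge⁻ a b c l ∘ in-c) _ (edges-connected c _ (<⇒≤ (≰⇒> x≰k) , x≤r))
  ++ʷ step (apex-edge-backward a b c l) _ here

Chain : Graph → ℕ → List ℕ → ℕ → Set
Chain R u [] w = R u w
Chain R u (x ∷ xs) w = R u x × Chain R x xs w

IsCycle : Graph → ℕ → List ℕ → Set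
IsCycle R v vs = 2 ≤ length vs × Unique (v ∷ vs) × Chain R v vs v

Acyclic : Graph → Set
Acyclic R = ∀ v vs → ¬ IsCycle R v vs

Chain-split : ∀ {R} u ys s zs w → Chain R u (ys ++ s ∷ zs) w → Chain R u ys s × Chain R s zs w
Chain-split u [] s zs w (r , p) = r , p
Chain-split u (y ∷ ys) s zs w (r , p) = let (p₁ , p₂) = Chain-split y ys s zs w p in (r , p₁) , p₂

Chain-join : ∀ {R} u ys s zs w → Chain R u ys s → Chain R s zs w → Chain R u (ys ++ s ∷ zs) w
Chain-join u [] s zs w r p = r , p
Chain-join u (y ∷ ys) s zs w (r , p₁) p₂ = r , Chain-join y ys s zs w p₁ p₂

Chain-head : ∀ {R} u xs w → Chain R u xs w → ∃ λ z → R u z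
Chain-head u [] w r = w , r
Chain-head u (x ∷ xs) w (r , _) = x , r

Unique-middle : ∀ ys {s : ℕ} {zs} → Unique (ys ++ s ∷ zs) → All (_≢ s) ys × All (_≢ s) zs
Unique-middle [] (s∉zs ∷ _) = [] , All.map (_∘ sym) s∉zs
Unique-middle (y ∷ ys) (y∉ ∷ u) =
  let (p , q) = Unique-middle ys u in All.lookup y∉ (∈-++⁺ʳ ys (here refl)) ∷ p , q

-- Two graphs R₁, R₂ whose vertex sets V₁, V₂ share only s: a cycle of their union passes
-- through s at most once, so it stays on one side.
module Gluing {R R₁ R₂ : Graph} {V₁ V₂ : ℕ → Set} (s : ℕ)
  (split : ∀ {x y} → R x y → R₁ x y ⊎ R₂ x y)
  (inside₁ : ∀ {x y} → R₁ x y → V₁ x × V₁ y)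
  (inside₂ : ∀ {x y} → R₂ x y → V₂ x × V₂ y)
  (meet : ∀ {x} → V₁ x → V₂ x → x ≡ s) where

  module Side {Rᵢ Rⱼ : Graph} {Vᵢ Vⱼ : ℕ → Set}
    (splitᵢ : ∀ {x y} → R x y → Rᵢ x y ⊎ Rⱼ x y)
    (insideᵢ : ∀ {x y} → Rᵢ x y → Vᵢ x × Vᵢ y)
    (insideⱼ : ∀ {x y} → Rⱼ x y → Vⱼ x × Vⱼ y)
    (meetᵢ : ∀ {x} → Vᵢ x → Vⱼ x → x ≡ s) where

    stays-from : ∀ {x y} → R x y → Vᵢ x → x ≢ s → Rᵢ x y
    stays-from r vx x≢s = [ id , (λ q → ⊥-elim (x≢s (meetᵢ vx (proj₁ (insideⱼ q))))) ]′ (splitᵢ r)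

    stays-to : ∀ {x y} → R x y → Vᵢ y → y ≢ s → Rᵢ x y
    stays-to r vy y≢s = [ id , (λ q → ⊥-elim (y≢s (meetᵢ vy (proj₂ (insideⱼ q))))) ]′ (splitᵢ r)

    Chain-start : ∀ u xs w → Chain Rᵢ u xs w → Vᵢ u
    Chain-start u [] w r = proj₁ (insideᵢ r)
    Chain-start u (x ∷ xs) w (r , _) = proj₁ (insideᵢ r)

    forward : ∀ u xs w → Vᵢ u → u ≢ s → All (_≢ s) xs → Chain R u xs w → Chain Rᵢ u xs w
    forward u [] w vu u≢s _ r = stays-from r vu u≢s
    forward u (x ∷ xs) w vu u≢s (x≢s ∷ xs≢s) (r , p) =
      let q = stays-from r vu u≢s in q , forward x xs w (proj₂ (insideᵢ q)) x≢s xs≢s p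

    backward : ∀ u xs w → Vᵢ w → w ≢ s → All (_≢ s) xs → Chain R u xs w → Chain Rᵢ u xs w
    backward u [] w vw w≢s _ r = stays-to r vw w≢s
    backward u (x ∷ xs) w vw w≢s (x≢s ∷ xs≢s) (r , p) =
      let q = backward x xs w vw w≢s xs≢s p in stays-to r (Chain-start x xs w q) x≢s , q

  module S₁ = Side split inside₁ inside₂ meet
  module S₂ = Side (Sum.swap ∘ split) inside₂ inside₁ (flip meet)

  first-side : ∀ {u z} → R u z → (V₁ u × V₁ z × R₁ u z) ⊎ (V₂ u × V₂ z × R₂ u z)
  first-side r = Sum.map (λ q → proj₁ (inside₁ q) , proj₂ (inside₁ q) , q)
                         (λ q → proj₁ (inside₂ q) , proj₂ (inside₂ q) , q) (split r)

  cycle-side : ∀ v vs → IsCycle R v vs → IsCycle R₁ v vs ⊎ IsCycle R₂ v vs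
  cycle-side v [] (() , _)
  cycle-side v (x ∷ xs) (len , u@(v∉ ∷ _) , (r , p)) with v ≟ s
  ... | yes refl = Sum.map (λ (_ , vx , q) → len , u , q , S₁.forward x xs v vx x≢v xs≢v p)
                           (λ (_ , vx , q) → len , u , q , S₂.forward x xs v vx x≢v xs≢v p) (first-side r)
    where
    x≢v : x ≢ v
    x≢v = All.head v∉ ∘ sym
    xs≢v : All (_≢ v) xs
    xs≢v = All.map (_∘ sym) (All.tail v∉)
  ... | no v≢s with s ∈? (x ∷ xs)
  ...   | no s∉ = Sum.map (λ (vv , _) → len , u , S₁.forward v (x ∷ xs) v vv v≢s vs≢s (r , p))
                          (λ (vv , _) → len , u , S₂.forward v (x ∷ xs) v vv v≢s vs≢s (r , p)) (first-side r)
    where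
    vs≢s : All (_≢ s) (x ∷ xs)
    vs≢s = All.tabulate (λ {y} y∈ y≡s → s∉ (subst (_∈ x ∷ xs) y≡s y∈))
  ...   | yes s∈ with ∈-∃++ s∈
  ...     | ys , zs , eq = subst (λ vs → IsCycle R₁ v vs ⊎ IsCycle R₂ v vs) (sym eq) (through-s ys zs (subst (λ vs → IsCycle R v vs) eq (len , u , r , p)))
    where
    through-s : ∀ ys zs → IsCycle R v (ys ++ s ∷ zs) → IsCycle R₁ v (ys ++ s ∷ zs) ⊎ IsCycle R₂ v (ys ++ s ∷ zs)
    through-s ys zs (len , u , p) =
      let (p₁ , p₂) = Chain-split v ys s zs v p
          (ys≢s , zs≢s) = Unique-middle ys (AP.tail u)
      in Sum.map (λ (vv , _) → len , u , Chain-join v ys s zs v (S₁.forward v ys s vv v≢s ys≢s p₁) (S₁.backward s zs v vv v≢s zs≢s p₂))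
                 (λ (vv , _) → len , u , Chain-join v ys s zs v (S₂.forward v ys s vv v≢s ys≢s p₁) (S₂.backward s zs v vv v≢s zs≢s p₂))
                 (first-side (proj₂ (Chain-head v ys s p₁)))

  acyclic-glue : Acyclic R₁ → Acyclic R₂ → Acyclic R
  acyclic-glue acyclic₁ acyclic₂ v vs c = [ acyclic₁ v vs , acyclic₂ v vs ]′ (cycle-side v vs c)

edge-acyclic : ∀ l k → Acyclic ⟦ edge l k ⟧
edge-acyclic l k v [] (() , _)
edge-acyclic l k v (_ ∷ []) (s≤s () , _)
edge-acyclic l k v (x₁ ∷ x₂ ∷ xs) (_ , ((v≢x₁ ∷ v≢x₂ ∷ _) ∷ (x₁≢x₂ ∷ _) ∷ _) , e₁ , e₂ , _)
  with edge-true l k v x₁ e₁ | edge-true l k x₁ x₂ e₂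
... | inj₁ (refl , refl) | inj₁ (x₁≡l , _) = v≢x₁ (sym x₁≡l)
... | inj₁ (refl , refl) | inj₂ (_ , refl) = v≢x₂ refl
... | inj₂ (refl , refl) | inj₁ (_ , refl) = v≢x₂ refl
... | inj₂ (refl , refl) | inj₂ (x₁≡k , _) = v≢x₁ (sym x₁≡k)

module _ (a b c : Ternary) (l : ℕ) where

  private
    p = end a l
    k = apex a b l
    r = end c k

  RootSide : Graph
  RootSide x y = edges a l x y ≡ true ⊎ edge l k x y ≡ true

  ApexSide : Graph
  ApexSide x y = edges b (suc p) x y ≡ true ⊎ edges c k x y ≡ true

  RootSide-acyclic : Acyclic ⟦ edges a l ⟧ → Acyclic RootSide
  RootSide-acyclic a-acyclic =
    Gluing.acyclic-glue l id (edges-between a l) edge-ends a∩edge a-acyclic (edge-acyclic l k)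
    where
    edge-ends : ∀ {x y} → edge l k x y ≡ true → (x ≡ l ⊎ x ≡ k) × (y ≡ l ⊎ y ≡ k)
    edge-ends {x} {y} e = [ (λ (p , q) → inj₁ p , inj₂ q) , (λ (p , q) → inj₂ p , inj₁ q) ]′ (edge-true l k x y e)
    a∩edge : ∀ {x} → Between l p x → x ≡ l ⊎ x ≡ k → x ≡ l
    a∩edge _ (inj₁ x≡l) = x≡l
    a∩edge (_ , x≤p) (inj₂ refl) = ⊥-elim (<⇒≱ (end<apex a b l) x≤p)

  ApexSide-acyclic : Acyclic ⟦ edges b (suc p) ⟧ → Acyclic ⟦ edges c k ⟧ → Acyclic ApexSide
  ApexSide-acyclic b-acyclic c-acyclic =
    Gluing.acyclic-glue k id (edges-between b _) (edges-between c k) (λ (_ , x≤k) (k≤x , _) → ≤-antisym x≤k k≤x)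
                        b-acyclic c-acyclic

  node-acyclic : Acyclic RootSide → Acyclic ApexSide → Acyclic ⟦ edges (node a b c) l ⟧
  node-acyclic left-acyclic right-acyclic = Gluing.acyclic-glue k split left-inside right-inside left∩right left-acyclic right-acyclic
    where
    split : ∀ {x y} → edges (node a b c) l x y ≡ true → RootSide x y ⊎ ApexSide x y
    split e with node-edge a b c l e
    ... | in-a e′ = inj₁ (inj₁ e′)
    ... | in-b e′ = inj₂ (inj₁ e′)
    ... | apex-edge e′ = inj₁ (inj₂ e′)
    ... | in-c e′ = inj₂ (inj₂ e′)
    left-inside : ∀ {x y} → RootSide x y → (Between l p x ⊎ x ≡ k) × (Between l p y ⊎ y ≡ k)
    left-inside (inj₁ e) = let (x-in , y-in) = edges-between a l e in inj₁ x-in , inj₁ y-in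
    left-inside {x} {y} (inj₂ e) with edge-true l k x y e
    ... | inj₁ (refl , refl) = inj₁ (≤-refl , ≤-end a l) , inj₂ refl
    ... | inj₂ (refl , refl) = inj₂ refl , inj₁ (≤-refl , ≤-end a l)
    right-inside : ∀ {x y} → ApexSide x y → Between (suc p) r x × Between (suc p) r y
    right-inside (inj₁ e) = BothBetween-mono ≤-refl (≤-end c k) (edges-between b _ e)
    right-inside (inj₂ e) = BothBetween-mono (end<apex a b l) ≤-refl (edges-between c k e)
    left∩right : ∀ {x} → Between l p x ⊎ x ≡ k → Between (suc p) r x → x ≡ k
    left∩right (inj₁ (_ , x≤p)) (p<x , _) = ⊥-elim (<⇒≱ p<x x≤p)
    left∩right (inj₂ x≡k) _ = x≡k

edges-acyclic : ∀ t l → Acyclic ⟦ edges t l ⟧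
edges-acyclic leaf l v vs (_ , _ , p) = case proj₂ (Chain-head v vs v p) of λ ()
edges-acyclic (node a b c) l =
  node-acyclic a b c l (RootSide-acyclic a b c l (edges-acyclic a l))
                       (ApexSide-acyclic a b c l (edges-acyclic b _) (edges-acyclic c _))

-- Reading a ternary tree off a noncrossing tree

greatest : (ℕ → Bool) → ℕ → Maybe ℕ
greatest p zero = nothing
greatest p (suc n) = if p n then just n else greatest p n

IsGreatest : (ℕ → Bool) → ℕ → ℕ → Set
IsGreatest p n u = u < n × p u ≡ true × (∀ v → u < v → v < n → p v ≡ false)

greatest-just : ∀ p n {u} → greatest p n ≡ just u → IsGreatest p n u
greatest-just p (suc n) e with p n in pn
greatest-just p (suc n) refl | true = ≤-refl , pn , λ v n<v v<1+n → ⊥-elim (<⇒≱ n<v (m<1+n⇒m≤n v<1+n))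
... | false =
  let (u<n , pu , above) = greatest-just p n e in
  m≤n⇒m≤1+n u<n , pu , λ v u<v v<1+n → [ above v u<v , (λ { refl → pn }) ]′ (m≤n⇒m<n∨m≡n (m<1+n⇒m≤n v<1+n))

greatest-nothing : ∀ p n → greatest p n ≡ nothing → ∀ v → v < n → p v ≡ false
greatest-nothing p (suc n) e v v<1+n with p n in pn
greatest-nothing p (suc n) () v v<1+n | true
... | false = [ greatest-nothing p n e v , (λ { refl → pn }) ]′ (m≤n⇒m<n∨m≡n (m<1+n⇒m≤n v<1+n))

greatest-≡just : ∀ p n {u} → IsGreatest p n u → greatest p n ≡ just u
greatest-≡just p (suc n) {u} (u<1+n , pu , above) with m≤n⇒m<n∨m≡n (m<1+n⇒m≤n u<1+n)
... | inj₂ refl rewrite pu = refl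
... | inj₁ u<n rewrite above n u<n ≤-refl =
  greatest-≡just p n (u<n , pu , λ v u<v v<n → above v u<v (m≤n⇒m≤1+n v<n))

greatest-≡nothing : ∀ p n → (∀ v → v < n → p v ≡ false) → greatest p n ≡ nothing
greatest-≡nothing p zero none = refl
greatest-≡nothing p (suc n) none rewrite none n ≤-refl =
  greatest-≡nothing p n (λ v v<n → none v (m≤n⇒m≤1+n v<n))

rightNeighbour : (ℕ → ℕ → Bool) → ℕ → ℕ → Bool
rightNeighbour G l v = (l <ᵇ v) ∧ G l v

rightNeighbour-true : ∀ G l v → rightNeighbour G l v ≡ true → l < v × G l v ≡ true
rightNeighbour-true G l v e = let (l<v , g) = ∧-true⁻ e in <ᵇ-true⇒< l v l<v , g

rightNeighbour-intro : ∀ G {l v} → l < v → G l v ≡ true → rightNeighbour G l v ≡ true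
rightNeighbour-intro G {l} {v} l<v g rewrite <⇒<ᵇ-true l<v = g

rightNeighbour-false : ∀ G {l v} → l < v → rightNeighbour G l v ≡ false → G l v ≡ false
rightNeighbour-false G {l} {v} l<v e rewrite <⇒<ᵇ-true l<v = e

rightNeighbour-absent : ∀ G l v → G l v ≡ false → rightNeighbour G l v ≡ false
rightNeighbour-absent G l v g rewrite g = ∧-zeroʳ (l <ᵇ v)

rightNeighbour-≤ : ∀ G {l v} → v ≤ l → rightNeighbour G l v ≡ false
rightNeighbour-≤ G v≤l rewrite ≥⇒<ᵇ-false v≤l = refl

-- The fuel f ≥ r ∸ l only ensures termination; the fallbacks (fromMaybe r, and leaf , leaf
-- when the fuel runs out) are never reached on noncrossing trees.
mutual
  decode : ℕ → (ℕ → ℕ → Bool) → ℕ → ℕ → Ternary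
  decode zero G l r = leaf
  decode (suc f) G l r = decode′ f G l r (l <ᵇ r)

  decode′ : ℕ → (ℕ → ℕ → Bool) → ℕ → ℕ → Bool → Ternary
  decode′ f G l r false = leaf
  decode′ f G l r true = decodeNode f G l (fromMaybe r (greatest (rightNeighbour G l) (suc r))) r

  decodeNode : ℕ → (ℕ → ℕ → Bool) → ℕ → ℕ → ℕ → Ternary
  decodeNode f G l k r = node (proj₁ (decodePair f G l k)) (proj₂ (decodePair f G l k)) (decode f G k r)

  decodePair : ℕ → (ℕ → ℕ → Bool) → ℕ → ℕ → Ternary × Ternary
  decodePair zero G l r = leaf , leaf
  decodePair (suc f) G l r = decodePair′ (suc f) G l r (greatest (rightNeighbour G l) r)

  decodePair′ : ℕ → (ℕ → ℕ → Bool) → ℕ → ℕ → Maybe ℕ → Ternary × Ternary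
  decodePair′ zero G l r _ = leaf , leaf
  decodePair′ (suc f) G l r nothing = leaf , decode (suc f) G (suc l) r
  decodePair′ (suc f) G l r (just c) =
    node (proj₁ (decodePair f G l c)) (proj₂ (decodePair f G l c)) (proj₁ (decodePair f G c r)) ,
    proj₂ (decodePair f G c r)

pairEdges : Ternary × Ternary → ℕ → ℕ → ℕ → Bool
pairEdges (a , b) l x y = edges a l x y ∨ edges b (suc (end a l)) x y

pairEnd : Ternary × Ternary → ℕ → ℕ
pairEnd (a , b) l = end b (suc (end a l))

fuel-shift : ∀ f {l k r} → l < k → r ≤ suc f + l → r ≤ f + k
fuel-shift f {l} l<k r≤ = ≤-trans r≤ (≤-trans (≤-reflexive (sym (+-suc f l))) (+-monoʳ-≤ f l<k))

mutual
  end-decode : ∀ f G l r → l ≤ r → r ≤ f + l → end (decode f G l r) l ≡ r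
  end-decode zero G l r l≤r r≤ = ≤-antisym l≤r r≤
  end-decode (suc f) G l r l≤r r≤ = end-decode′ f G l r l≤r r≤ (l <ᵇ r) refl

  end-decode′ : ∀ f G l r → l ≤ r → r ≤ suc f + l → (b : Bool) → (l <ᵇ r) ≡ b → end (decode′ f G l r b) l ≡ r
  end-decode′ f G l r l≤r r≤ false e = ≤-antisym l≤r (<ᵇ-false⇒≥ l r e)
  end-decode′ f G l r l≤r r≤ true e = end-decodeNode f G l r (<ᵇ-true⇒< l r e) r≤ _ refl

  end-decodeNode : ∀ f G l r → l < r → r ≤ suc f + l → (m : Maybe ℕ) → greatest (rightNeighbour G l) (suc r) ≡ m →
                   end (decodeNode f G l (fromMaybe r m) r) l ≡ r
  end-decodeNode f G l r l<r r≤ nothing _ = end-decodeNode′ f G l r r l<r ≤-refl r≤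
  end-decodeNode f G l r l<r r≤ (just k) eq =
    let (k<1+r , k-adj , _) = greatest-just (rightNeighbour G l) (suc r) eq in
    end-decodeNode′ f G l k r (proj₁ (rightNeighbour-true G l k k-adj)) (m<1+n⇒m≤n k<1+r) r≤

  end-decodeNode′ : ∀ f G l k r → l < k → k ≤ r → r ≤ suc f + l → end (decodeNode f G l k r) l ≡ r
  end-decodeNode′ f G l k r l<k k≤r r≤ rewrite pairEnd-decodePair f G l k l<k (≤-trans k≤r r≤) =
    end-decode f G k r k≤r (fuel-shift f l<k r≤)

  pairEnd-decodePair : ∀ f G l r → l < r → r ≤ suc f + l → pairEnd (decodePair f G l r) l ≡ r
  pairEnd-decodePair zero G l r l<r r≤ = ≤-antisym l<r r≤
  pairEnd-decodePair (suc f) G l r l<r r≤ = pairEnd-decodePair′ (suc f) G l r l<r r≤ _ refl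

  pairEnd-decodePair′ : ∀ f G l r → l < r → r ≤ suc f + l → (m : Maybe ℕ) → greatest (rightNeighbour G l) r ≡ m →
                        pairEnd (decodePair′ f G l r m) l ≡ r
  pairEnd-decodePair′ zero G l r l<r r≤ _ _ = ≤-antisym l<r r≤
  pairEnd-decodePair′ (suc f) G l r l<r r≤ nothing _ =
    end-decode (suc f) G (suc l) r l<r (≤-trans r≤ (≤-reflexive (sym (+-suc (suc f) l))))
  pairEnd-decodePair′ (suc f) G l r l<r r≤ (just c) eq =
    let (c<r , c-adj , _) = greatest-just (rightNeighbour G l) r eq
        l<c = proj₁ (rightNeighbour-true G l c c-adj) in
    trans (cong (λ z → end (proj₂ (decodePair f G c r)) (suc (end (proj₁ (decodePair f G c r)) z)))
                (pairEnd-decodePair f G l c l<c (m<1+n⇒m≤n (≤-trans c<r r≤))))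
          (pairEnd-decodePair f G c r c<r (fuel-shift (suc f) l<c r≤))

StrictlyBetween : ℕ → ℕ → ℕ → Set
StrictlyBetween a b x = a < x × x < b

strictlyBetween⇒between : ∀ {a b x} → StrictlyBetween a b x → Between a b x
strictlyBetween⇒between (a<x , x<b) = <⇒≤ a<x , <⇒≤ x<b

WalkIn-mapᴾ : ∀ {R R′ : Graph} {P P′ : ℕ → Set} {x z} → P x → (∀ {u v} → P u → P v → R u v → R′ u v) →
              (∀ {u} → P u → P′ u) → WalkIn R P x z → WalkIn R′ P′ x z
WalkIn-mapᴾ px f g here = here
WalkIn-mapᴾ px f g (step r py w) = step (f px py r) (g py) (WalkIn-mapᴾ py f g w)

record Exit (R : Graph) (Q : ℕ → Set) (a b v : ℕ) : Set where
  constructor exit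
  field
    {last next} : ℕ
    inner       : WalkIn R (StrictlyBetween a b) v last
    last-inside : StrictlyBetween a b last
    leaving     : R last next
    through     : next ≡ a ⊎ next ≡ b
    next-ok     : Q next

first-exit : ∀ {R : Graph} {Q : ℕ → Set} a b → (∀ {x y} → a < x → x < b → R x y → Q y → Between a b y) →
             ∀ {v t} → StrictlyBetween a b v → ¬ StrictlyBetween a b t → WalkIn R Q v t → Exit R Q a b v
first-exit a b stays v-in t-out here = ⊥-elim (t-out v-in)
first-exit a b stays v-in@(a<v , v<b) t-out (step r qy w) with stays a<v v<b r qy
... | (a≤y , y≤b) with m≤n⇒m<n∨m≡n a≤y | m≤n⇒m<n∨m≡n y≤b
...   | inj₂ a≡y | _ = exit here v-in r (inj₁ (sym a≡y)) qy
...   | inj₁ _ | inj₂ y≡b = exit here v-in r (inj₂ y≡b) qy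
...   | inj₁ a<y | inj₁ y<b =
  let exit inner last-in leaving through ok = first-exit a b stays (a<y , y<b) t-out w in
  exit (step r (a<y , y<b) inner) last-in leaving through ok

-- The decoder reads decode on intervals where G is Connected, and decodePair on intervals
-- [l, r] where G is connected only together with the extra edge l – r.
module Connectivity (G : ℕ → ℕ → Bool)
  (G-sym : ∀ {x y} → G x y ≡ true → G y x ≡ true)
  (G-irrefl : ∀ x → G x x ≡ false)
  (G-nonCrossing : NonCrossing ⟦ G ⟧) where

  WithEdge : ℕ → ℕ → Graph
  WithEdge l r x y = G x y ≡ true ⊎ (x ≡ l × y ≡ r) ⊎ (x ≡ r × y ≡ l)

  Connected : ℕ → ℕ → Set
  Connected l r = ∀ u → Between l r u → WalkIn ⟦ G ⟧ (Between l r) u l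

  ConnectedWithEdge : ℕ → ℕ → Set
  ConnectedWithEdge l r = ∀ u → Between l r u → WalkIn (WithEdge l r) (Between l r) u l

  adjacent⇒≢ : ∀ {x y} → G x y ≡ true → x ≢ y
  adjacent⇒≢ {x} e refl = true≢false (trans (sym e) (G-irrefl x))

  no-crossing : ∀ {a b c d} → G a b ≡ true → G c d ≡ true → a < c → c < b → b < d → ⊥
  no-crossing ab cd a<c c<b b<d = G-nonCrossing _ _ _ _ ab cd (<-trans a<c c<b) (<-trans c<b b<d) (a<c , c<b , b<d)

  chord-confines : ∀ {l k x y} → G l k ≡ true → l < x → x < k → G x y ≡ true → l ≤ y → y ≤ k
  chord-confines {l} {k} {x} {y} lk l<x x<k xy l≤y with y ≤? k
  ... | yes y≤k = y≤k
  ... | no y≰k = ⊥-elim (no-crossing lk xy l<x x<k (≰⇒> y≰k))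

  rightNeighbour-exists : ∀ {l r} → Connected l r → l < r → ∃ λ z → l < z × z ≤ r × G l z ≡ true
  rightNeighbour-exists {l} {r} conn l<r =
    let (z , (l≤z , z≤r) , zl) = WalkIn-last (λ r≡l → <-irrefl (sym r≡l) l<r) (<⇒≤ l<r , ≤-refl) (conn r (<⇒≤ l<r , ≤-refl)) in
    z , ≤∧≢⇒< l≤z (adjacent⇒≢ zl ∘ sym) , z≤r , G-sym zl

  WithEdge⇒adjacent : ∀ {l r x y} → x ≢ l → x ≢ r → WithEdge l r x y → G x y ≡ true
  WithEdge⇒adjacent _ _ (inj₁ e) = e
  WithEdge⇒adjacent x≢l _ (inj₂ (inj₁ (x≡l , _))) = ⊥-elim (x≢l x≡l)
  WithEdge⇒adjacent _ x≢r (inj₂ (inj₂ (x≡r , _))) = ⊥-elim (x≢r x≡r)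

  WithEdge⇒adjacent′ : ∀ {l r x y} → x ≢ l → y ≢ l → WithEdge l r x y → G x y ≡ true
  WithEdge⇒adjacent′ _ _ (inj₁ e) = e
  WithEdge⇒adjacent′ x≢l _ (inj₂ (inj₁ (x≡l , _))) = ⊥-elim (x≢l x≡l)
  WithEdge⇒adjacent′ _ y≢l (inj₂ (inj₂ (_ , y≡l))) = ⊥-elim (y≢l y≡l)

  above⇒≢ : ∀ {a x} → a < x → x ≢ a
  above⇒≢ a<x refl = <-irrefl refl a<x

  below⇒≢ : ∀ {b x} → x < b → x ≢ b
  below⇒≢ x<b refl = <-irrefl refl x<b

  connected-below-apex : ∀ {l r k} → Connected l r → G l k ≡ true → l < k → k ≤ r → ConnectedWithEdge l k
  connected-below-apex {l} {r} {k} conn lk l<k k≤r u (l≤u , u≤k) with m≤n⇒m<n∨m≡n l≤u | m≤n⇒m<n∨m≡n u≤k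
  ... | inj₂ refl | _ = here
  ... | inj₁ _ | inj₂ refl = step (inj₁ (G-sym lk)) (≤-refl , <⇒≤ l<k) here
  ... | inj₁ l<u | inj₁ u<k =
    leave (first-exit l k (λ l<x x<k xy (l≤y , _) → l≤y , chord-confines lk l<x x<k xy l≤y)
                      (l<u , u<k) (λ (l<l , _) → <-irrefl refl l<l) (conn u (l≤u , ≤-trans u≤k k≤r)))
    where
    leave : Exit ⟦ G ⟧ (Between l r) l k u → WalkIn (WithEdge l k) (Between l k) u l
    leave (exit inner last-in e through _) =
      WalkIn-mapᴾ (l<u , u<k) (λ _ _ → inj₁) strictlyBetween⇒between inner ++ʷ final e through
      where
      final : ∀ {y v} → G y v ≡ true → v ≡ l ⊎ v ≡ k → WalkIn (WithEdge l k) (Between l k) y l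
      final g (inj₁ refl) = step (inj₁ g) (≤-refl , <⇒≤ l<k) here
      final g (inj₂ refl) = step (inj₁ g) (<⇒≤ l<k , ≤-refl) (step (inj₁ (G-sym lk)) (≤-refl , <⇒≤ l<k) here)

  connected-above-apex : ∀ {l r k} → Connected l r → G l k ≡ true → l < k → k ≤ r →
                         (∀ v → k < v → v ≤ r → G l v ≡ false) → Connected k r
  connected-above-apex {l} {r} {k} conn lk l<k k≤r beyond u (k≤u , u≤r) with m≤n⇒m<n∨m≡n k≤u
  ... | inj₂ refl = here
  ... | inj₁ k<u =
    leave (first-exit k (suc r) stays (k<u , s≤s u≤r) (λ (k<l , _) → <-asym k<l l<k) (conn u (<⇒≤ (<-trans l<k k<u) , u≤r)))
    where
    stays : ∀ {x y} → k < x → x < suc r → G x y ≡ true → Between l r y → Between k (suc r) y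
    stays {x} {y} k<x x<1+r xy (l≤y , y≤r) with k ≤? y | m≤n⇒m<n∨m≡n l≤y
    ... | yes k≤y | _ = k≤y , m≤n⇒m≤1+n y≤r
    ... | no _ | inj₂ refl = ⊥-elim (true≢false (trans (sym (G-sym xy)) (beyond x k<x (m<1+n⇒m≤n x<1+r))))
    ... | no k≰y | inj₁ l<y = ⊥-elim (no-crossing lk (G-sym xy) l<y (≰⇒> k≰y) k<x)
    leave : Exit ⟦ G ⟧ (Between l r) k (suc r) u → WalkIn ⟦ G ⟧ (Between k r) u k
    leave (exit inner _ e (inj₁ refl) _) =
      WalkIn-mapᴾ (k<u , s≤s u≤r) (λ _ _ e → e) (λ (k<x , x<1+r) → <⇒≤ k<x , m<1+n⇒m≤n x<1+r) inner
      ++ʷ step e (≤-refl , k≤r) here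
    leave (exit _ _ _ (inj₂ refl) (_ , 1+r≤r)) = ⊥-elim (<-irrefl refl 1+r≤r)

  connected-without-root : ∀ {l r} → ConnectedWithEdge l r → l < r → (∀ v → l < v → v < r → G l v ≡ false) →
                           Connected (suc l) r
  connected-without-root {l} {r} conn l<r none u u-in =
    to-r u u-in ++ʷ WalkIn-reverse G-sym (≤-refl , l<r) (to-r (suc l) (≤-refl , l<r))
    where
    to-r : ∀ u → Between (suc l) r u → WalkIn ⟦ G ⟧ (Between (suc l) r) u r
    to-r u (l<u , u≤r) with first-exit l (suc r) (λ _ _ _ (l≤y , y≤r) → l≤y , m≤n⇒m≤1+n y≤r) (l<u , s≤s u≤r)
                                       (λ (l<l , _) → <-irrefl refl l<l) (conn u (<⇒≤ l<u , u≤r))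
    ... | exit inner (l<y , y<1+r) e through ok =
      subst (WalkIn ⟦ G ⟧ (Between (suc l) r) u) (last≡r e through ok)
        (WalkIn-mapᴾ (l<u , s≤s u≤r) (λ (l<x , _) (l<y , _) → WithEdge⇒adjacent′ (above⇒≢ l<x) (above⇒≢ l<y))
                     (λ (l<x , x<1+r) → l<x , m<1+n⇒m≤n x<1+r) inner)
      where
      last≡r : ∀ {v} → WithEdge l r _ v → v ≡ l ⊎ v ≡ suc r → Between l r v → _ ≡ r
      last≡r _ (inj₂ refl) (_ , 1+r≤r) = ⊥-elim (<-irrefl refl 1+r≤r)
      last≡r (inj₂ (inj₂ (y≡r , _))) (inj₁ refl) _ = y≡r
      last≡r (inj₂ (inj₁ (y≡l , _))) (inj₁ refl) _ = ⊥-elim (above⇒≢ l<y y≡l)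
      last≡r (inj₁ g) (inj₁ refl) _ with m≤n⇒m<n∨m≡n (m<1+n⇒m≤n y<1+r)
      ... | inj₂ y≡r = y≡r
      ... | inj₁ y<r = ⊥-elim (true≢false (trans (sym (G-sym g)) (none _ l<y y<r)))

  connected-left-part : ∀ {l r c} → ConnectedWithEdge l r → G l c ≡ true → l < c → c < r → ConnectedWithEdge l c
  connected-left-part {l} {r} {c} conn lc l<c c<r u (l≤u , u≤c) with m≤n⇒m<n∨m≡n l≤u | m≤n⇒m<n∨m≡n u≤c
  ... | inj₂ refl | _ = here
  ... | inj₁ _ | inj₂ refl = step (inj₁ (G-sym lc)) (≤-refl , <⇒≤ l<c) here
  ... | inj₁ l<u | inj₁ u<c =
    leave (first-exit l c stays (l<u , u<c) (λ (l<l , _) → <-irrefl refl l<l) (conn u (l≤u , ≤-trans u≤c (<⇒≤ c<r))))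
    where
    in-G : ∀ {x y} → l < x → x < c → WithEdge l r x y → G x y ≡ true
    in-G l<x x<c = WithEdge⇒adjacent (above⇒≢ l<x) (below⇒≢ (<-trans x<c c<r))
    stays : ∀ {x y} → l < x → x < c → WithEdge l r x y → Between l r y → Between l c y
    stays l<x x<c xy (l≤y , _) = l≤y , chord-confines lc l<x x<c (in-G l<x x<c xy) l≤y
    leave : Exit (WithEdge l r) (Between l r) l c u → WalkIn (WithEdge l c) (Between l c) u l
    leave (exit inner (l<y , y<c) e through _) =
      WalkIn-mapᴾ (l<u , u<c) (λ (l<x , _) (l<y , _) xy → inj₁ (WithEdge⇒adjacent′ (above⇒≢ l<x) (above⇒≢ l<y) xy))
                  strictlyBetween⇒between inner
      ++ʷ final (in-G l<y y<c e) through
      where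
      final : ∀ {y v} → G y v ≡ true → v ≡ l ⊎ v ≡ c → WalkIn (WithEdge l c) (Between l c) y l
      final g (inj₁ refl) = step (inj₁ g) (≤-refl , <⇒≤ l<c) here
      final g (inj₂ refl) = step (inj₁ g) (<⇒≤ l<c , ≤-refl) (step (inj₁ (G-sym lc)) (≤-refl , <⇒≤ l<c) here)

  connected-right-part : ∀ {l r c} → ConnectedWithEdge l r → G l c ≡ true → l < c → c < r →
                         (∀ v → c < v → v < r → G l v ≡ false) → ConnectedWithEdge c r
  connected-right-part {l} {r} {c} conn lc l<c c<r beyond u (c≤u , u≤r) with m≤n⇒m<n∨m≡n c≤u | m≤n⇒m<n∨m≡n u≤r
  ... | inj₂ refl | _ = here
  ... | inj₁ _ | inj₂ refl = step (inj₂ (inj₂ (refl , refl))) (≤-refl , <⇒≤ c<r) here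
  ... | inj₁ c<u | inj₁ u<r =
    leave (first-exit c r stays (c<u , u<r) (λ (c<l , _) → <-asym c<l l<c) (conn u (<⇒≤ (<-trans l<c c<u) , u≤r)))
    where
    not-l : ∀ {x} → c < x → x ≢ l
    not-l c<x refl = <-asym c<x l<c
    in-G : ∀ {x y} → c < x → x < r → WithEdge l r x y → G x y ≡ true
    in-G c<x x<r = WithEdge⇒adjacent (not-l c<x) (below⇒≢ x<r)
    stays : ∀ {x y} → c < x → x < r → WithEdge l r x y → Between l r y → Between c r y
    stays {x} {y} c<x x<r xy (l≤y , y≤r) with c ≤? y | m≤n⇒m<n∨m≡n l≤y
    ... | yes c≤y | _ = c≤y , y≤r
    ... | no _ | inj₂ refl = ⊥-elim (true≢false (trans (sym (G-sym (in-G c<x x<r xy))) (beyond x c<x x<r)))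
    ... | no c≰y | inj₁ l<y = ⊥-elim (no-crossing lc (G-sym (in-G c<x x<r xy)) l<y (≰⇒> c≰y) c<x)
    leave : Exit (WithEdge l r) (Between l r) c r u → WalkIn (WithEdge c r) (Between c r) u c
    leave (exit inner (c<y , y<r) e through _) =
      WalkIn-mapᴾ (c<u , u<r) (λ (c<x , _) (c<y , _) xy → inj₁ (WithEdge⇒adjacent′ (not-l c<x) (not-l c<y) xy))
                  strictlyBetween⇒between inner
      ++ʷ final (in-G c<y y<r e) through
      where
      final : ∀ {y v} → G y v ≡ true → v ≡ c ⊎ v ≡ r → WalkIn (WithEdge c r) (Between c r) y c
      final g (inj₁ refl) = step (inj₁ g) (≤-refl , <⇒≤ c<r) here
      final g (inj₂ refl) = step (inj₁ g) (<⇒≤ c<r , ≤-refl) (step (inj₂ (inj₂ (refl , refl))) (≤-refl , <⇒≤ c<r) here)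

Agree : (ℕ → ℕ → Bool) → (ℕ → ℕ → Bool) → ℕ → ℕ → Set
Agree H G l r = ∀ x y → Between l r x → Between l r y → H x y ≡ G x y

AgreeOffEdge : (ℕ → ℕ → Bool) → (ℕ → ℕ → Bool) → ℕ → ℕ → Set
AgreeOffEdge H G l r = ∀ x y → Between l r x → Between l r y → edge l r x y ≡ false → H x y ≡ G x y

data Position (k x y : ℕ) : Set where
  both-≤    : x ≤ k → y ≤ k → Position k x y
  both-≥    : k ≤ x → k ≤ y → Position k x y
  straddle  : x < k → k < y → Position k x y
  straddle′ : y < k → k < x → Position k x y

position : ∀ k x y → Position k x y
position k x y with x ≤? k | y ≤? k
... | yes x≤k | yes y≤k = both-≤ x≤k y≤k
... | no x≰k | no y≰k = both-≥ (<⇒≤ (≰⇒> x≰k)) (<⇒≤ (≰⇒> y≰k))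
... | yes x≤k | no y≰k with k ≤? x
...   | yes k≤x = both-≥ k≤x (<⇒≤ (≰⇒> y≰k))
...   | no k≰x = straddle (≰⇒> k≰x) (≰⇒> y≰k)
position k x y | no x≰k | yes y≤k with k ≤? y
...   | yes k≤y = both-≥ (<⇒≤ (≰⇒> x≰k)) k≤y
...   | no k≰y = straddle′ (≰⇒> k≰y) (≰⇒> x≰k)

module Decoding (G : ℕ → ℕ → Bool)
  (G-sym : ∀ {x y} → G x y ≡ true → G y x ≡ true)
  (G-irrefl : ∀ x → G x x ≡ false)
  (G-nonCrossing : NonCrossing ⟦ G ⟧)
  (G-acyclic : Acyclic ⟦ G ⟧) where

  open Connectivity G G-sym G-irrefl G-nonCrossing

  -- DownPath r l: l is joined to r through vertices below l.  Together with an edge l – c,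
  -- l < c < r, it turns an edge c – r into a cycle.
  data DownPath (r : ℕ) : ℕ → Set where
    base : ∀ {l} → G l r ≡ true → DownPath r l
    cons : ∀ {c l} → G c l ≡ true → l < c → DownPath r l → DownPath r c

  DownPath-vertices : ∀ {r l} → DownPath r l → List ℕ
  DownPath-vertices (base {l} _) = l ∷ []
  DownPath-vertices (cons {c} _ _ p) = c ∷ DownPath-vertices p

  DownPath-chain : ∀ {r l c} (p : DownPath r l) → G c l ≡ true → Chain ⟦ G ⟧ c (DownPath-vertices p) r
  DownPath-chain (base e) e′ = e′ , e
  DownPath-chain (cons e _ p) e′ = e′ , DownPath-chain p e

  DownPath-≤ : ∀ {r l} (p : DownPath r l) → All (_≤ l) (DownPath-vertices p)
  DownPath-≤ (base _) = ≤-refl ∷ []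
  DownPath-≤ (cons _ l<c p) = ≤-refl ∷ All.map (λ v≤l → ≤-trans v≤l (<⇒≤ l<c)) (DownPath-≤ p)

  DownPath-descending : ∀ {r l} (p : DownPath r l) → AllPairs _>_ (DownPath-vertices p)
  DownPath-descending (base _) = [] ∷ []
  DownPath-descending (cons _ l<c p) = All.map (λ v≤l → ≤-<-trans v≤l l<c) (DownPath-≤ p) ∷ DownPath-descending p

  DownPath-¬chord : ∀ {r l c} → DownPath r l → G l c ≡ true → l < c → c < r → G c r ≡ true → ⊥
  DownPath-¬chord {r} {l} {c} p lc l<c c<r cr =
    G-acyclic r (c ∷ DownPath-vertices p) (s≤s (length-nonempty p) , unique , G-sym cr , DownPath-chain p (G-sym lc))
    where
    below-c : All (_< c) (DownPath-vertices p)
    below-c = All.map (λ v≤l → ≤-<-trans v≤l l<c) (DownPath-≤ p)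
    length-nonempty : ∀ {l} (p : DownPath r l) → 1 ≤ length (DownPath-vertices p)
    length-nonempty (base _) = s≤s z≤n
    length-nonempty (cons _ _ _) = s≤s z≤n
    unique : Unique (r ∷ c ∷ DownPath-vertices p)
    unique = AP.map (λ gt e → <-irrefl (sym e) gt)
               ((c<r ∷ All.map (λ v<c → <-trans v<c c<r) below-c) ∷ below-c ∷ DownPath-descending p)

  singleton-no-edge : ∀ {l r x y} → r ≤ l → Between l r x → Between l r y → G x y ≡ false
  singleton-no-edge r≤l (l≤x , x≤r) (l≤y , y≤r)
    with ≤-antisym (≤-trans x≤r r≤l) l≤x | ≤-antisym (≤-trans y≤r r≤l) l≤y
  ... | refl | refl = G-irrefl _

  doubleton-no-edge : ∀ {l r x y} → r ≤ suc l → Between l r x → Between l r y → edge l r x y ≡ false → G x y ≡ false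
  doubleton-no-edge {l} {r} {x} {y} r≤1+l (l≤x , x≤r) (l≤y , y≤r) e
    with m≤n⇒m<n∨m≡n l≤x | m≤n⇒m<n∨m≡n l≤y
  ... | inj₂ refl | inj₂ refl = G-irrefl l
  ... | inj₁ l<x | inj₁ l<y with ≤-antisym x≤r (≤-trans r≤1+l l<x) | ≤-antisym y≤r (≤-trans r≤1+l l<y)
  ...   | refl | refl = G-irrefl r
  doubleton-no-edge {l} {r} {x} {y} r≤1+l (l≤x , x≤r) (l≤y , y≤r) e
    | inj₂ refl | inj₁ l<y with ≤-antisym y≤r (≤-trans r≤1+l l<y)
  ...   | refl = ⊥-elim (true≢false (trans (sym (edge-forward l r)) e))
  doubleton-no-edge {l} {r} {x} {y} r≤1+l (l≤x , x≤r) (l≤y , y≤r) e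
    | inj₁ l<x | inj₂ refl with ≤-antisym x≤r (≤-trans r≤1+l l<x)
  ...   | refl = ⊥-elim (true≢false (trans (sym (edge-backward l r)) e))

  jump-from-root : ∀ {l k u v} → G l k ≡ true → l ≤ u → u < k → k < v → G u v ≡ true → u ≡ l
  jump-from-root lk l≤u u<k k<v g with m≤n⇒m<n∨m≡n l≤u
  ... | inj₁ l<u = ⊥-elim (no-crossing lk g l<u u<k k<v)
  ... | inj₂ l≡u = sym l≡u

  pair-sound : ∀ a b l → AgreeOffEdge (pairEdges (a , b) l) G l (apex a b l) →
               ∀ {x y} → edges a l x y ≡ true ⊎ edges b (suc (end a l)) x y ≡ true → G x y ≡ true
  pair-sound a b l agree {x} {y} (inj₁ e) =
    let ((l≤x , x≤p) , (l≤y , y≤p)) = edges-between a l e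
        x<k = ≤-<-trans x≤p (end<apex a b l)
        y<k = ≤-<-trans y≤p (end<apex a b l) in
    trans (sym (agree x y (l≤x , <⇒≤ x<k) (l≤y , <⇒≤ y<k) (edge-false-below x<k y<k))) (∨-trueˡ _ e)
  pair-sound a b l agree {x} {y} (inj₂ e) =
    let ((p<x , x≤k) , (p<y , y≤k)) = edges-between b _ e
        l<x = <-≤-trans (s≤s (≤-end a l)) p<x
        l<y = <-≤-trans (s≤s (≤-end a l)) p<y in
    trans (sym (agree x y (<⇒≤ l<x , x≤k) (<⇒≤ l<y , y≤k) (edge-false-above l<x l<y))) (∨-trueʳ (edges a l x y) e)

  edge-sound : ∀ {l k x y} → G l k ≡ true → edge l k x y ≡ true → G x y ≡ true
  edge-sound {l} {k} {x} {y} lk e = [ (λ { (refl , refl) → lk }) , (λ { (refl , refl) → G-sym lk }) ]′ (edge-true l k x y e)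

  node-edges-sound : ∀ a b c l → G l (apex a b l) ≡ true → AgreeOffEdge (pairEdges (a , b) l) G l (apex a b l) →
                     Agree (edges c (apex a b l)) G (apex a b l) (end c (apex a b l)) →
                     ∀ {x y} → edges (node a b c) l x y ≡ true → G x y ≡ true
  node-edges-sound a b c l lk agree-ab agree-c e with node-edge a b c l e
  ... | in-a e′ = pair-sound a b l agree-ab (inj₁ e′)
  ... | in-b e′ = pair-sound a b l agree-ab (inj₂ e′)
  ... | apex-edge e′ = edge-sound lk e′
  ... | in-c e′ = let (bx , by) = edges-between c _ e′ in trans (sym (agree-c _ _ bx by)) e′

  node-edges-complete : ∀ a b c l r → G l (apex a b l) ≡ true → (∀ v → apex a b l < v → v ≤ r → G l v ≡ false) →
                        AgreeOffEdge (pairEdges (a , b) l) G l (apex a b l) → Agree (edges c (apex a b l)) G (apex a b l) r →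
                        ∀ {x y} → Between l r x → Between l r y → G x y ≡ true → edges (node a b c) l x y ≡ true
  node-edges-complete a b c l r lk beyond agree-ab agree-c {x} {y} (l≤x , x≤r) (l≤y , y≤r) g
    with position (apex a b l) x y
  ... | both-≥ k≤x k≤y = node-edge⁻ a b c l (in-c (trans (agree-c x y (k≤x , x≤r) (k≤y , y≤r)) g))
  ... | straddle x<k k<y with jump-from-root lk l≤x x<k k<y g
  ...   | refl = ⊥-elim (true≢false (trans (sym g) (beyond y k<y y≤r)))
  node-edges-complete a b c l r lk beyond agree-ab agree-c {x} {y} (l≤x , x≤r) (l≤y , y≤r) g
    | straddle′ y<k k<x with jump-from-root lk l≤y y<k k<x (G-sym g)
  ...   | refl = ⊥-elim (true≢false (trans (sym (G-sym g)) (beyond x k<x x≤r)))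
  node-edges-complete a b c l r lk beyond agree-ab agree-c {x} {y} (l≤x , x≤r) (l≤y , y≤r) g
    | both-≤ x≤k y≤k with edge l (apex a b l) x y ≟B true
  ...   | yes e = node-edge⁻ a b c l (apex-edge e)
  ...   | no ¬e = [ node-edge⁻ a b c l ∘ in-a , node-edge⁻ a b c l ∘ in-b ]′
                    (∨-true⁻ (trans (agree-ab x y (l≤x , x≤k) (l≤y , y≤k) (¬true⇒false ¬e)) g))

  node-edges : ∀ a b c l k r → apex a b l ≡ k → G l k ≡ true → (∀ v → k < v → v ≤ r → G l v ≡ false) →
               AgreeOffEdge (pairEdges (a , b) l) G l k → Agree (edges c k) G k r → end c k ≡ r →
               Agree (edges (node a b c) l) G l r
  node-edges a b c l _ r refl lk beyond agree-ab agree-c refl x y bx by =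
    true⇔true⇒≡ (node-edges-sound a b c l lk agree-ab agree-c)
                (node-edges-complete a b c l r lk beyond agree-ab agree-c bx by)

  split-edges-sound : ∀ a₁ b₁ a₂ b₂ l → G l (apex a₁ b₁ l) ≡ true →
                      AgreeOffEdge (pairEdges (a₁ , b₁) l) G l (apex a₁ b₁ l) →
                      AgreeOffEdge (pairEdges (a₂ , b₂) (apex a₁ b₁ l)) G (apex a₁ b₁ l) (apex a₂ b₂ (apex a₁ b₁ l)) →
                      ∀ {x y} → pairEdges (node a₁ b₁ a₂ , b₂) l x y ≡ true → G x y ≡ true
  split-edges-sound a₁ b₁ a₂ b₂ l lc agree₁ agree₂ {x} {y} e with ∨-true⁻ {edges (node a₁ b₁ a₂) l x y} e
  ... | inj₂ e′ = pair-sound a₂ b₂ _ agree₂ (inj₂ e′)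
  ... | inj₁ e′ with node-edge a₁ b₁ a₂ l e′
  ...   | in-a e″ = pair-sound a₁ b₁ l agree₁ (inj₁ e″)
  ...   | in-b e″ = pair-sound a₁ b₁ l agree₁ (inj₂ e″)
  ...   | apex-edge e″ = edge-sound lc e″
  ...   | in-c e″ = pair-sound a₂ b₂ _ agree₂ (inj₁ e″)

  split-edges-complete : ∀ a₁ b₁ a₂ b₂ l r → G l (apex a₁ b₁ l) ≡ true → apex a₁ b₁ l < r →
                         (∀ v → apex a₁ b₁ l < v → v < r → G l v ≡ false) → DownPath r l →
                         AgreeOffEdge (pairEdges (a₁ , b₁) l) G l (apex a₁ b₁ l) →
                         AgreeOffEdge (pairEdges (a₂ , b₂) (apex a₁ b₁ l)) G (apex a₁ b₁ l) r →
                         ∀ {x y} → Between l r x → Between l r y → edge l r x y ≡ false → G x y ≡ true →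
                         pairEdges (node a₁ b₁ a₂ , b₂) l x y ≡ true
  split-edges-complete a₁ b₁ a₂ b₂ l r lc c<r beyond p agree₁ agree₂ {x} {y} (l≤x , x≤r) (l≤y , y≤r) not-lr g
    with position (apex a₁ b₁ l) x y
  ... | both-≤ x≤c y≤c with edge l (apex a₁ b₁ l) x y ≟B true
  ...   | yes e = ∨-trueˡ _ (node-edge⁻ a₁ b₁ a₂ l (apex-edge e))
  ...   | no ¬e = [ ∨-trueˡ _ ∘ node-edge⁻ a₁ b₁ a₂ l ∘ in-a , ∨-trueˡ _ ∘ node-edge⁻ a₁ b₁ a₂ l ∘ in-b ]′
                    (∨-true⁻ (trans (agree₁ x y (l≤x , x≤c) (l≤y , y≤c) (¬true⇒false ¬e)) g))
  split-edges-complete a₁ b₁ a₂ b₂ l r lc c<r beyond p agree₁ agree₂ {x} {y} (l≤x , x≤r) (l≤y , y≤r) not-lr g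
    | both-≥ c≤x c≤y with edge (apex a₁ b₁ l) r x y ≟B true
  ...   | yes e = ⊥-elim (DownPath-¬chord p lc (start<apex a₁ b₁ l) c<r (edge-sound g (edge-converse {apex a₁ b₁ l} {r} {x} {y} e)))
  ...   | no ¬e = [ ∨-trueˡ _ ∘ node-edge⁻ a₁ b₁ a₂ l ∘ in-c , ∨-trueʳ (edges (node a₁ b₁ a₂) l x y) ]′
                    (∨-true⁻ (trans (agree₂ x y (c≤x , x≤r) (c≤y , y≤r) (¬true⇒false ¬e)) g))
  split-edges-complete a₁ b₁ a₂ b₂ l r lc c<r beyond p agree₁ agree₂ {x} {y} (l≤x , x≤r) (l≤y , y≤r) not-lr g
    | straddle x<c c<y with jump-from-root lc l≤x x<c c<y g | m≤n⇒m<n∨m≡n y≤r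
  ...   | refl | inj₁ y<r = ⊥-elim (true≢false (trans (sym g) (beyond y c<y y<r)))
  ...   | refl | inj₂ refl = ⊥-elim (true≢false (trans (sym (edge-forward l r)) not-lr))
  split-edges-complete a₁ b₁ a₂ b₂ l r lc c<r beyond p agree₁ agree₂ {x} {y} (l≤x , x≤r) (l≤y , y≤r) not-lr g
    | straddle′ y<c c<x with jump-from-root lc l≤y y<c c<x (G-sym g) | m≤n⇒m<n∨m≡n x≤r
  ...   | refl | inj₁ x<r = ⊥-elim (true≢false (trans (sym (G-sym g)) (beyond x c<x x<r)))
  ...   | refl | inj₂ refl = ⊥-elim (true≢false (trans (sym (edge-backward l r)) not-lr))

  split-edges : ∀ a₁ b₁ a₂ b₂ l c r → apex a₁ b₁ l ≡ c → G l c ≡ true → c < r →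
                (∀ v → c < v → v < r → G l v ≡ false) → DownPath r l →
                AgreeOffEdge (pairEdges (a₁ , b₁) l) G l c → AgreeOffEdge (pairEdges (a₂ , b₂) c) G c r →
                apex a₂ b₂ c ≡ r → AgreeOffEdge (pairEdges (node a₁ b₁ a₂ , b₂) l) G l r
  split-edges a₁ b₁ a₂ b₂ l _ r refl lc c<r beyond p agree₁ agree₂ refl x y bx by not-lr =
    true⇔true⇒≡ (split-edges-sound a₁ b₁ a₂ b₂ l lc agree₁ agree₂)
                (split-edges-complete a₁ b₁ a₂ b₂ l r lc c<r beyond p agree₁ agree₂ bx by not-lr)

  root-row-false : ∀ {l r} → (∀ v → l < v → v < r → G l v ≡ false) → ∀ v → Between l r v → v ≢ r → G l v ≡ false
  root-row-false none v (l≤v , v≤r) v≢r with m≤n⇒m<n∨m≡n l≤v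
  ... | inj₁ l<v = none v l<v (≤∧≢⇒< v≤r v≢r)
  ... | inj₂ refl = G-irrefl v

  leaf-edges : ∀ t l r → (∀ v → l < v → v < r → G l v ≡ false) → Agree (edges t (suc l)) G (suc l) r →
               AgreeOffEdge (pairEdges (leaf , t) l) G l r
  leaf-edges t l r none agree x y (l≤x , x≤r) (l≤y , y≤r) not-lr with m≤n⇒m<n∨m≡n l≤x | m≤n⇒m<n∨m≡n l≤y
  ... | inj₁ l<x | inj₁ l<y = agree x y (l<x , x≤r) (l<y , y≤r)
  ... | inj₂ refl | _ =
    trans (¬true⇒false λ e → <-irrefl refl (proj₁ (proj₁ (edges-between t _ e))))
          (sym (root-row-false none y (l≤y , y≤r) λ { refl → true≢false (trans (sym (edge-forward x r)) not-lr) }))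
  ... | inj₁ _ | inj₂ refl =
    trans (¬true⇒false λ e → <-irrefl refl (proj₁ (proj₂ (edges-between t _ e))))
          (sym (¬true⇒false λ g → true≢false (trans (sym (G-sym g))
            (root-row-false none x (l≤x , x≤r) λ { refl → true≢false (trans (sym (edge-backward y r)) not-lr) }))))

  mutual
    edges-decode : ∀ f l r → l ≤ r → r ≤ f + l → Connected l r → Agree (edges (decode f G l r) l) G l r
    edges-decode zero l r l≤r r≤l conn x y bx by = sym (singleton-no-edge r≤l bx by)
    edges-decode (suc f) l r l≤r r≤ conn = edges-decode′ f l r l≤r r≤ conn (l <ᵇ r) refl

    edges-decode′ : ∀ f l r → l ≤ r → r ≤ suc f + l → Connected l r → (b : Bool) → (l <ᵇ r) ≡ b →
                    Agree (edges (decode′ f G l r b) l) G l r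
    edges-decode′ f l r l≤r r≤ conn false l≮ᵇr x y bx by = sym (singleton-no-edge (<ᵇ-false⇒≥ l r l≮ᵇr) bx by)
    edges-decode′ f l r l≤r r≤ conn true l<ᵇr = edges-decodeNode f l r (<ᵇ-true⇒< l r l<ᵇr) r≤ conn _ refl

    edges-decodeNode : ∀ f l r → l < r → r ≤ suc f + l → Connected l r → (m : Maybe ℕ) → greatest (rightNeighbour G l) (suc r) ≡ m →
                       Agree (edges (decodeNode f G l (fromMaybe r m) r) l) G l r
    edges-decodeNode f l r l<r r≤ conn nothing eq =
      let (z , l<z , z≤r , lz) = rightNeighbour-exists conn l<r in
      ⊥-elim (true≢false (trans (sym lz) (rightNeighbour-false G l<z (greatest-nothing _ (suc r) eq z (s≤s z≤r)))))
    edges-decodeNode f l r l<r r≤ conn (just k) eq =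
      let (k<1+r , lk′ , above) = greatest-just _ (suc r) eq
          (l<k , lk) = rightNeighbour-true G l k lk′
          k≤r = m<1+n⇒m≤n k<1+r
          beyond : ∀ v → k < v → v ≤ r → G l v ≡ false
          beyond v k<v v≤r = rightNeighbour-false G (<-trans l<k k<v) (above v k<v (s≤s v≤r))
          k≤1+f+l = ≤-trans k≤r r≤ in
      node-edges (proj₁ (decodePair f G l k)) (proj₂ (decodePair f G l k)) (decode f G k r) l k r
        (pairEnd-decodePair f G l k l<k k≤1+f+l) lk beyond
        (pairEdges-decodePair f l k l<k k≤1+f+l (base lk) (connected-below-apex conn lk l<k k≤r))
        (edges-decode f k r k≤r (fuel-shift f l<k r≤) (connected-above-apex conn lk l<k k≤r beyond))
        (end-decode f G k r k≤r (fuel-shift f l<k r≤))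

    pairEdges-decodePair : ∀ f l r → l < r → r ≤ suc f + l → DownPath r l → ConnectedWithEdge l r →
                           AgreeOffEdge (pairEdges (decodePair f G l r) l) G l r
    pairEdges-decodePair zero l r l<r r≤ p conn x y bx by not-lr = sym (doubleton-no-edge r≤ bx by not-lr)
    pairEdges-decodePair (suc f) l r l<r r≤ p conn = pairEdges-decodePair′ (suc f) l r l<r r≤ p conn _ refl

    pairEdges-decodePair′ : ∀ f l r → l < r → r ≤ suc f + l → DownPath r l → ConnectedWithEdge l r →
                            (m : Maybe ℕ) → greatest (rightNeighbour G l) r ≡ m →
                            AgreeOffEdge (pairEdges (decodePair′ f G l r m) l) G l r
    pairEdges-decodePair′ zero l r l<r r≤ p conn _ _ x y bx by not-lr = sym (doubleton-no-edge r≤ bx by not-lr)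
    pairEdges-decodePair′ (suc f) l r l<r r≤ p conn nothing eq =
      leaf-edges (decode (suc f) G (suc l) r) l r none
        (edges-decode (suc f) (suc l) r l<r (≤-trans r≤ (≤-reflexive (sym (+-suc (suc f) l))))
                      (connected-without-root conn l<r none))
      where
      none : ∀ v → l < v → v < r → G l v ≡ false
      none v l<v v<r = rightNeighbour-false G l<v (greatest-nothing _ r eq v v<r)
    pairEdges-decodePair′ (suc f) l r l<r r≤ p conn (just c) eq =
      let (c<r , lc′ , above) = greatest-just _ r eq
          (l<c , lc) = rightNeighbour-true G l c lc′
          beyond : ∀ v → c < v → v < r → G l v ≡ false
          beyond v c<v v<r = rightNeighbour-false G (<-trans l<c c<v) (above v c<v v<r)
          c≤1+f+l = m<1+n⇒m≤n (≤-trans c<r r≤)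
          r≤1+f+c = fuel-shift (suc f) l<c r≤ in
      split-edges (proj₁ (decodePair f G l c)) (proj₂ (decodePair f G l c))
                  (proj₁ (decodePair f G c r)) (proj₂ (decodePair f G c r)) l c r
        (pairEnd-decodePair f G l c l<c c≤1+f+l) lc c<r beyond p
        (pairEdges-decodePair f l c l<c c≤1+f+l (base lc) (connected-left-part conn lc l<c c<r))
        (pairEdges-decodePair f c r c<r r≤1+f+c (cons (G-sym lc) l<c p) (connected-right-part conn lc l<c c<r beyond))
        (pairEnd-decodePair f G c r c<r r≤1+f+c)

end≤start⇒leaf : ∀ t l → end t l ≤ l → t ≡ leaf
end≤start⇒leaf leaf l _ = refl
end≤start⇒leaf (node a b c) l r≤l = ⊥-elim (<⇒≱ (<-≤-trans (start<apex a b l) (≤-end c _)) r≤l)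

edges-outside : ∀ t l {x y} → ¬ BothBetween l (end t l) x y → edges t l x y ≡ false
edges-outside t l out = ¬true⇒false (out ∘ edges-between t l)

edges-left-of-start : ∀ t l {x y} → x < l → edges t l x y ≡ false
edges-left-of-start t l x<l = edges-outside t l λ ((l≤x , _) , _) → <⇒≱ x<l l≤x

edges-right-of-end : ∀ t l {x y} → end t l < x → edges t l x y ≡ false
edges-right-of-end t l r<x = edges-outside t l λ ((_ , x≤r) , _) → <⇒≱ r<x x≤r

edges-at-most-start : ∀ t l {x y} → x ≤ l → y ≤ l → edges t l x y ≡ false
edges-at-most-start t l {x} {y} x≤l y≤l = ¬true⇒false λ e →
  let ((l≤x , _) , (l≤y , _)) = edges-between t l e in
  true≢false (trans (sym e) (subst₂ (λ u v → edges t l u v ≡ false) (≤-antisym l≤x x≤l) (≤-antisym l≤y y≤l) (edges-irreflexive t l l)))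

edges-at-least-end : ∀ t l {x y} → end t l ≤ x → end t l ≤ y → edges t l x y ≡ false
edges-at-least-end t l {x} {y} r≤x r≤y = ¬true⇒false λ e →
  let ((_ , x≤r) , (_ , y≤r)) = edges-between t l e in
  true≢false (trans (sym e) (subst₂ (λ u v → edges t l u v ≡ false) (≤-antisym r≤x x≤r) (≤-antisym r≤y y≤r) (edges-irreflexive t l _)))

node-edges-up-to-apex : ∀ a b c l {x y} → x ≤ apex a b l → y ≤ apex a b l → edge l (apex a b l) x y ≡ false →
                        edges (node a b c) l x y ≡ pairEdges (a , b) l x y
node-edges-up-to-apex a b c l {x} {y} x≤k y≤k not-lk
  rewrite not-lk | edges-at-most-start c (apex a b l) x≤k y≤k = cong (edges a l x y ∨_) (∨-identityʳ _)

node-edges-from-apex : ∀ a b c l {x y} → apex a b l ≤ x → apex a b l ≤ y →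
                       edges (node a b c) l x y ≡ edges c (apex a b l) x y
node-edges-from-apex a b c l {x} {y} k≤x k≤y
  rewrite edges-right-of-end a l {y = y} (<-≤-trans (end<apex a b l) k≤x)
        | edges-at-least-end b (suc (end a l)) k≤x k≤y
        | edge-false-above {k = apex a b l} (<-≤-trans (start<apex a b l) k≤x) (<-≤-trans (start<apex a b l) k≤y) = refl

split-edges-up-to-apex : ∀ a₁ b₁ a₂ b₂ l {x y} → x ≤ apex a₁ b₁ l → y ≤ apex a₁ b₁ l → edge l (apex a₁ b₁ l) x y ≡ false →
                         pairEdges (node a₁ b₁ a₂ , b₂) l x y ≡ pairEdges (a₁ , b₁) l x y
split-edges-up-to-apex a₁ b₁ a₂ b₂ l {x} {y} x≤c y≤c not-lc
  rewrite node-edges-up-to-apex a₁ b₁ a₂ l x≤c y≤c not-lc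
        | edges-left-of-start b₂ (suc (end a₂ (apex a₁ b₁ l))) {y = y} (s≤s (≤-trans x≤c (≤-end a₂ _))) = ∨-identityʳ _

split-edges-from-apex : ∀ a₁ b₁ a₂ b₂ l {x y} → apex a₁ b₁ l ≤ x → apex a₁ b₁ l ≤ y →
                        pairEdges (node a₁ b₁ a₂ , b₂) l x y ≡ pairEdges (a₂ , b₂) (apex a₁ b₁ l) x y
split-edges-from-apex a₁ b₁ a₂ b₂ l c≤x c≤y rewrite node-edges-from-apex a₁ b₁ a₂ l c≤x c≤y = refl

root-row-beyond-apex : ∀ a b c l {v} → apex a b l < v → edges (node a b c) l l v ≡ false
root-row-beyond-apex a b c l {v} k<v = ¬true⇒false λ e → case node-edge a b c l e of λ where
  (in-a e′) → <⇒≱ (<-trans (end<apex a b l) k<v) (proj₂ (proj₂ (edges-between a l e′)))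
  (in-b e′) → <⇒≱ (s≤s (≤-end a l)) (proj₁ (proj₁ (edges-between b _ e′)))
  (apex-edge e′) → [ (λ (_ , v≡k) → <⇒≢ k<v (sym v≡k)) , (λ (l≡k , _) → <⇒≢ (start<apex a b l) l≡k) ]′ (edge-true l _ l v e′)
  (in-c e′) → <⇒≱ (start<apex a b l) (proj₁ (proj₁ (edges-between c _ e′)))

module _ (G : ℕ → ℕ → Bool) where

  greatest-neighbour-node : ∀ a b c l → Agree G (edges (node a b c) l) l (end (node a b c) l) →
                            greatest (rightNeighbour G l) (suc (end (node a b c) l)) ≡ just (apex a b l)
  greatest-neighbour-node a b c l agree =
    greatest-≡just _ _ (s≤s k≤r , rightNeighbour-intro G l<k lk , not-beyond)
    where
    k≤r = ≤-end c (apex a b l)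
    l<k = start<apex a b l
    l-in = (≤-refl , ≤-trans (<⇒≤ l<k) k≤r)
    lk : G l (apex a b l) ≡ true
    lk = trans (agree _ _ l-in (<⇒≤ l<k , k≤r)) (apex-edge-forward a b c l)
    not-beyond : ∀ v → apex a b l < v → v < suc (end c (apex a b l)) → rightNeighbour G l v ≡ false
    not-beyond v k<v v<1+r = rightNeighbour-absent G l v
      (trans (agree _ _ l-in (<⇒≤ (<-trans l<k k<v) , m<1+n⇒m≤n v<1+r)) (root-row-beyond-apex a b c l k<v))

  greatest-neighbour-leaf-pair : ∀ b l → AgreeOffEdge G (pairEdges (leaf , b) l) l (end b (suc l)) →
                                 greatest (rightNeighbour G l) (end b (suc l)) ≡ nothing
  greatest-neighbour-leaf-pair b l agree = greatest-≡nothing _ _ none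
    where
    none : ∀ v → v < end b (suc l) → rightNeighbour G l v ≡ false
    none v v<r with v ≤? l
    ... | yes v≤l = rightNeighbour-≤ G v≤l
    ... | no v≰l =
      let l<v = ≰⇒> v≰l in
      rightNeighbour-absent G l v
        (trans (agree l v (≤-refl , <⇒≤ (<-trans l<v v<r)) (<⇒≤ l<v , <⇒≤ v<r) (edge-false-below (<-trans l<v v<r) v<r))
               (edges-left-of-start b (suc l) ≤-refl))

  greatest-neighbour-node-pair : ∀ a₁ b₁ a₂ b l → let r = pairEnd (node a₁ b₁ a₂ , b) l in
                                 AgreeOffEdge G (pairEdges (node a₁ b₁ a₂ , b) l) l r →
                                 greatest (rightNeighbour G l) r ≡ just (apex a₁ b₁ l)
  greatest-neighbour-node-pair a₁ b₁ a₂ b l agree =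
    greatest-≡just _ _ (c<r , rightNeighbour-intro G l<c lc , not-beyond)
    where
    c = apex a₁ b₁ l
    r = pairEnd (node a₁ b₁ a₂ , b) l
    l<c = start<apex a₁ b₁ l
    c<r : c < r
    c<r = <-≤-trans (s≤s (≤-end a₂ c)) (≤-end b _)
    l-in = (≤-refl , <⇒≤ (<-trans l<c c<r))
    lc : G l c ≡ true
    lc = trans (agree l c l-in (<⇒≤ l<c , <⇒≤ c<r) (edge-false-below (<-trans l<c c<r) c<r))
               (∨-trueˡ _ (apex-edge-forward a₁ b₁ a₂ l))
    not-beyond : ∀ v → c < v → v < r → rightNeighbour G l v ≡ false
    not-beyond v c<v v<r = rightNeighbour-absent G l v
      (trans (agree l v l-in (<⇒≤ (<-trans l<c c<v) , <⇒≤ v<r) (edge-false-below (<-trans (<-trans l<c c<v) v<r) v<r))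
             (cong₂ _∨_ (root-row-beyond-apex a₁ b₁ a₂ l c<v) (edges-left-of-start b _ (s≤s (≤-trans (<⇒≤ l<c) (≤-end a₂ c))))))

  mutual
    decode-edges : ∀ t l f → end t l ≤ f + l → Agree G (edges t l) l (end t l) → decode f G l (end t l) ≡ t
    decode-edges t l zero r≤l agree = sym (end≤start⇒leaf t l r≤l)
    decode-edges leaf l (suc f) _ agree rewrite ≥⇒<ᵇ-false (≤-refl {l}) = refl
    decode-edges (node a b c) l (suc f) r≤ agree
      rewrite <⇒<ᵇ-true (<-≤-trans (start<apex a b l) (≤-end c (apex a b l)))
            | greatest-neighbour-node a b c l agree
      = cong₂ (λ ab c′ → node (proj₁ ab) (proj₂ ab) c′)
          (decodePair-edges a b l f (≤-trans (≤-end c k) r≤) agree-ab)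
          (decode-edges c k f (fuel-shift f (start<apex a b l) r≤) agree-c)
      where
      k = apex a b l
      k≤r = ≤-end c k
      agree-ab : AgreeOffEdge G (pairEdges (a , b) l) l k
      agree-ab x y (l≤x , x≤k) (l≤y , y≤k) not-lk =
        trans (agree x y (l≤x , ≤-trans x≤k k≤r) (l≤y , ≤-trans y≤k k≤r)) (node-edges-up-to-apex a b c l x≤k y≤k not-lk)
      agree-c : Agree G (edges c k) k (end c k)
      agree-c x y (k≤x , x≤r) (k≤y , y≤r) =
        trans (agree x y (<⇒≤ (<-≤-trans (start<apex a b l) k≤x) , x≤r) (<⇒≤ (<-≤-trans (start<apex a b l) k≤y) , y≤r))
              (node-edges-from-apex a b c l k≤x k≤y)

    decodePair-edges : ∀ a b l f → pairEnd (a , b) l ≤ suc f + l → AgreeOffEdge G (pairEdges (a , b) l) l (pairEnd (a , b) l) →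
                       decodePair f G l (pairEnd (a , b) l) ≡ (a , b)
    decodePair-edges a b l zero r≤1+l agree with end≤start⇒leaf a l (m<1+n⇒m≤n (≤-trans (≤-end b _) r≤1+l))
    ... | refl with end≤start⇒leaf b (suc l) r≤1+l
    ...   | refl = refl
    decodePair-edges leaf b l (suc f) r≤ agree rewrite greatest-neighbour-leaf-pair b l agree =
      cong (leaf ,_) (decode-edges b (suc l) (suc f) (≤-trans r≤ (≤-reflexive (sym (+-suc (suc f) l)))) agree-b)
      where
      agree-b : Agree G (edges b (suc l)) (suc l) (end b (suc l))
      agree-b x y (l<x , x≤r) (l<y , y≤r) = agree x y (<⇒≤ l<x , x≤r) (<⇒≤ l<y , y≤r) (edge-false-above l<x l<y)
    decodePair-edges (node a₁ b₁ a₂) b l (suc f) r≤ agree rewrite greatest-neighbour-node-pair a₁ b₁ a₂ b l agree =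
      cong₂ (λ ab₁ ab₂ → node (proj₁ ab₁) (proj₂ ab₁) (proj₁ ab₂) , proj₂ ab₂)
        (decodePair-edges a₁ b₁ l f (m<1+n⇒m≤n (≤-trans c<r r≤)) agree₁)
        (decodePair-edges a₂ b c f (fuel-shift (suc f) l<c r≤) agree₂)
      where
      c = apex a₁ b₁ l
      r = pairEnd (a₂ , b) c
      l<c = start<apex a₁ b₁ l
      c<r : c < r
      c<r = <-≤-trans (s≤s (≤-end a₂ c)) (≤-end b _)
      agree₁ : AgreeOffEdge G (pairEdges (a₁ , b₁) l) l c
      agree₁ x y (l≤x , x≤c) (l≤y , y≤c) not-lc =
        trans (agree x y (l≤x , <⇒≤ (≤-<-trans x≤c c<r)) (l≤y , <⇒≤ (≤-<-trans y≤c c<r))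
                     (edge-false-below (≤-<-trans x≤c c<r) (≤-<-trans y≤c c<r)))
              (split-edges-up-to-apex a₁ b₁ a₂ b l x≤c y≤c not-lc)
      agree₂ : AgreeOffEdge G (pairEdges (a₂ , b) c) c r
      agree₂ x y (c≤x , x≤r) (c≤y , y≤r) not-cr =
        trans (agree x y (<⇒≤ (<-≤-trans l<c c≤x) , x≤r) (<⇒≤ (<-≤-trans l<c c≤y) , y≤r)
                     (edge-false-above (<-≤-trans l<c c≤x) (<-≤-trans l<c c≤y)))
              (split-edges-from-apex a₁ b₁ a₂ b l c≤x c≤y)

-- Adjacency matrices

-- The adjacency matrix read as a relation on ℕ, false outside the vertex set.
entry : ∀ {m} → Vec (Vec Bool m) m → ℕ → ℕ → Bool
entry {m} M x y with x <? m | y <? m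
... | yes x<m | yes y<m = lookup (lookup M (fromℕ< x<m)) (fromℕ< y<m)
... | _ | _ = false

entry-lookup : ∀ {m} (M : Vec (Vec Bool m) m) (i j : Fin m) → entry M (toℕ i) (toℕ j) ≡ lookup (lookup M i) j
entry-lookup {m} M i j with toℕ i <? m | toℕ j <? m
... | yes i<m | yes j<m rewrite fromℕ<-toℕ i i<m | fromℕ<-toℕ j j<m = refl
... | yes _ | no j≮m = ⊥-elim (j≮m (toℕ<n j))
... | no i≮m | _ = ⊥-elim (i≮m (toℕ<n i))

entry-true : ∀ {m} (M : Vec (Vec Bool m) m) x y → entry M x y ≡ true →
             Σ (x < m) λ x<m → Σ (y < m) λ y<m → Adj M (fromℕ< x<m) (fromℕ< y<m)
entry-true {m} M x y e with x <? m | y <? m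
... | yes x<m | yes y<m = x<m , y<m , e
... | yes _ | no _ = ⊥-elim (true≢false (sym e))
... | no _ | _ = ⊥-elim (true≢false (sym e))

matrix : ∀ m → (ℕ → ℕ → Bool) → Vec (Vec Bool m) m
matrix m E = tabulate λ i → tabulate λ j → E (toℕ i) (toℕ j)

lookup-matrix : ∀ m E (i j : Fin m) → lookup (lookup (matrix m E) i) j ≡ E (toℕ i) (toℕ j)
lookup-matrix m E i j =
  trans (cong (λ row → lookup row j) (lookup∘tabulate (λ i → tabulate λ j → E (toℕ i) (toℕ j)) i))
        (lookup∘tabulate (λ j → E (toℕ i) (toℕ j)) j)

matrix-lookup : ∀ m (M : Vec (Vec Bool m) m) E → (∀ i j → E (toℕ i) (toℕ j) ≡ lookup (lookup M i) j) → matrix m E ≡ M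
matrix-lookup m M E agree =
  trans (tabulate-cong λ i → trans (tabulate-cong (agree i)) (tabulate∘lookup (lookup M i))) (tabulate∘lookup M)

entry-matrix : ∀ m E {x y} → x < m → y < m → entry (matrix m E) x y ≡ E x y
entry-matrix m E x<m y<m =
  trans (sym (cong₂ (entry (matrix m E)) (toℕ-fromℕ< x<m) (toℕ-fromℕ< y<m)))
        (trans (entry-lookup (matrix m E) (fromℕ< x<m) (fromℕ< y<m))
               (trans (lookup-matrix m E (fromℕ< x<m) (fromℕ< y<m)) (cong₂ E (toℕ-fromℕ< x<m) (toℕ-fromℕ< y<m))))

module ToMatrix (m : ℕ) (E : ℕ → ℕ → Bool) (E-bounded : ∀ {x y} → E x y ≡ true → x < m × y < m) where

  adj : ∀ {i j : Fin m} → E (toℕ i) (toℕ j) ≡ true → Adj (matrix m E) i j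
  adj {i} {j} e = trans (lookup-matrix m E i j) e

  adj⁻ : ∀ {i j : Fin m} → Adj (matrix m E) i j → E (toℕ i) (toℕ j) ≡ true
  adj⁻ {i} {j} e = trans (sym (lookup-matrix m E i j)) e

  walk : ∀ {P x z} (i j : Fin m) → toℕ i ≡ x → toℕ j ≡ z → WalkIn ⟦ E ⟧ P x z → Walk (matrix m E) i j
  walk i j refl j≡ here with toℕ-injective j≡
  ... | refl = here
  walk i j refl j≡ (step e _ w) =
    let y<m = proj₂ (E-bounded e) in
    step (adj (subst (λ y → E (toℕ i) y ≡ true) (sym (toℕ-fromℕ< y<m)) e)) (walk (fromℕ< y<m) j (toℕ-fromℕ< y<m) j≡ w)

  chain : ∀ {v u : Fin m} xs → CycleEdges (matrix m E) v u xs → Chain ⟦ E ⟧ (toℕ u) (map toℕ xs) (toℕ v)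
  chain [] e = adj⁻ e
  chain (x ∷ xs) (e , es) = adj⁻ e , chain xs es

  isNCTree : (∀ {x y} → E x y ≡ true → E y x ≡ true) → (∀ x → E x x ≡ false) → NonCrossing ⟦ E ⟧ → Acyclic ⟦ E ⟧ →
             (∀ x → x < m → WalkIn ⟦ E ⟧ (λ _ → ⊤) x 0) → IsNCTree m (matrix m E)
  isNCTree E-sym E-irrefl E-nonCrossing E-acyclic E-connected = record
    { symmetric = λ i j e → adj (E-sym (adj⁻ e))
    ; loopless = λ i e → true≢false (trans (sym (adj⁻ e)) (E-irrefl (toℕ i)))
    ; connected = λ i j → walk i j refl refl
        (E-connected (toℕ i) (toℕ<n i) ++ʷ WalkIn-reverse E-sym _ (E-connected (toℕ j) (toℕ<n j)))
    ; acyclic = λ (v , vs , 3≤len , u , c) →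
        E-acyclic (toℕ v) (map toℕ vs)
          (≤-trans (≤-pred 3≤len) (≤-reflexive (sym (length-map toℕ vs))) , UP.map⁺ toℕ-injective u , chain vs c)
    ; noncrossing = λ a b c d e₁ e₂ a<b c<d → E-nonCrossing _ _ _ _ (adj⁻ e₁) (adj⁻ e₂) a<b c<d
    }

module FromMatrix (n : ℕ) (M : Vec (Vec Bool (suc n)) (suc n)) (nct : IsNCTree (suc n) M) where

  G : ℕ → ℕ → Bool
  G = entry M

  adj⇒entry : ∀ {i j} → Adj M i j → G (toℕ i) (toℕ j) ≡ true
  adj⇒entry {i} {j} a = trans (entry-lookup M i j) a

  entry⇒adj : ∀ x y → G x y ≡ true → Σ (x < suc n) λ x<m → Σ (y < suc n) λ y<m → Adj M (fromℕ< x<m) (fromℕ< y<m)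
  entry⇒adj = entry-true M

  G-sym : ∀ {x y} → G x y ≡ true → G y x ≡ true
  G-sym {x} {y} e = let (x<m , y<m , a) = entry⇒adj x y e in
    subst₂ (λ u v → G u v ≡ true) (toℕ-fromℕ< y<m) (toℕ-fromℕ< x<m) (adj⇒entry (symmetric nct _ _ a))

  G-irrefl : ∀ x → G x x ≡ false
  G-irrefl x = ¬true⇒false λ e → let (x<m , x<m′ , a) = entry⇒adj x x e in
    loopless nct _ (subst (Adj M (fromℕ< x<m)) (toℕ-injective (trans (toℕ-fromℕ< x<m′) (sym (toℕ-fromℕ< x<m)))) a)

  G-nonCrossing : NonCrossing ⟦ G ⟧
  G-nonCrossing a b c d e₁ e₂ a<b c<d (a<c , c<b , b<d) =
    let (a<m , b<m , A₁) = entry⇒adj a b e₁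
        (c<m , d<m , A₂) = entry⇒adj c d e₂
        fin< : ∀ {u v} (u<m : u < suc n) (v<m : v < suc n) → u < v → fromℕ< u<m F.< fromℕ< v<m
        fin< u<m v<m = subst₂ _<_ (sym (toℕ-fromℕ< u<m)) (sym (toℕ-fromℕ< v<m))
    in noncrossing nct _ _ _ _ A₁ A₂ (fin< a<m b<m a<b) (fin< c<m d<m c<d)
         (fin< a<m c<m a<c , fin< c<m b<m c<b , fin< b<m d<m b<d)

  cycle-edges : ∀ u xs w → Chain ⟦ G ⟧ u xs w → (u′ w′ : Fin (suc n)) → toℕ u′ ≡ u → toℕ w′ ≡ w →
                Σ (List (Fin (suc n))) λ fs → map toℕ fs ≡ xs × CycleEdges M w′ u′ fs
  cycle-edges u [] w e u′ w′ refl refl = [] , refl , trans (sym (entry-lookup M u′ w′)) e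
  cycle-edges u (x ∷ xs) w (e , es) u′ w′ refl w≡ =
    let (_ , x<m , _) = entry⇒adj u x e
        (fs , fs≡ , ce) = cycle-edges x xs w es (fromℕ< x<m) w′ (toℕ-fromℕ< x<m) w≡
    in fromℕ< x<m ∷ fs , cong₂ _∷_ (toℕ-fromℕ< x<m) fs≡ ,
       (trans (sym (entry-lookup M u′ (fromℕ< x<m))) (subst (λ z → G (toℕ u′) z ≡ true) (sym (toℕ-fromℕ< x<m)) e) , ce)

  G-acyclic : Acyclic ⟦ G ⟧
  G-acyclic v vs (2≤len , u , p) =
    let (z , vz) = Chain-head v vs v p
        (v<m , _) = entry⇒adj v z vz
        v′ = fromℕ< v<m
        (fs , fs≡ , ce) = cycle-edges v vs v p v′ v′ (toℕ-fromℕ< v<m) (toℕ-fromℕ< v<m)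
    in acyclic nct (v′ , fs , s≤s (subst (2 ≤_) (trans (cong length (sym fs≡)) (length-map toℕ fs)) 2≤len) ,
                    UP.map⁻ (subst Unique (sym (cong₂ _∷_ (toℕ-fromℕ< v<m) fs≡)) u) , ce)

  walk : ∀ {i j} → Walk M i j → WalkIn ⟦ G ⟧ (Between 0 n) (toℕ i) (toℕ j)
  walk here = here
  walk (step {j = k} a w) = step (adj⇒entry a) (z≤n , ≤-pred (toℕ<n k)) (walk w)

  G-connected : Connectivity.Connected G (λ {x} {y} → G-sym {x} {y}) G-irrefl G-nonCrossing 0 n
  G-connected u (_ , u≤n) =
    subst (λ z → WalkIn ⟦ G ⟧ (Between 0 n) z 0) (toℕ-fromℕ< (s≤s u≤n)) (walk (connected nct (fromℕ< (s≤s u≤n)) F.zero))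

  matrix-decode : matrix (suc n) (edges (decode n G 0 n) 0) ≡ M
  matrix-decode = matrix-lookup (suc n) M (edges (decode n G 0 n) 0) λ i j →
    trans (Decoding.edges-decode G (λ {x} {y} → G-sym {x} {y}) G-irrefl G-nonCrossing G-acyclic n 0 n z≤n (≤-reflexive (sym (+-identityʳ n)))
             G-connected (toℕ i) (toℕ j) (z≤n , ≤-pred (toℕ<n i)) (z≤n , ≤-pred (toℕ<n j)))
          (entry-lookup M i j)

TernaryOfSize : ℕ → Set
TernaryOfSize n = Σ Ternary λ t → size t ≡ n

TernaryOfSize-≡ : ∀ {n} {s t : TernaryOfSize n} → proj₁ s ≡ proj₁ t → s ≡ t
TernaryOfSize-≡ {s = t , e} {.t , e′} refl = cong (t ,_) (≡-irrelevant e e′)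

end-0 : ∀ t → end t 0 ≡ size t
end-0 t = trans (end-size t 0) (+-identityʳ (size t))

toNCTree : ∀ n → TernaryOfSize n → NCTree (suc n)
toNCTree n (t , size≡n) =
  nctree (matrix (suc n) (edges t 0))
    (ToMatrix.isNCTree (suc n) (edges t 0) bounded (edges-sym t 0) (edges-irreflexive t 0) (edges-nonCrossing t 0)
       (edges-acyclic t 0) λ x x<1+n → edges-connected t 0 (z≤n , subst (x ≤_) (sym end≡n) (≤-pred x<1+n)))
  where
  end≡n : end t 0 ≡ n
  end≡n = trans (end-0 t) size≡n
  bounded : ∀ {x y} → edges t 0 x y ≡ true → x < suc n × y < suc n
  bounded e = let ((_ , x≤r) , (_ , y≤r)) = edges-between t 0 e in
    s≤s (subst (_ ≤_) end≡n x≤r) , s≤s (subst (_ ≤_) end≡n y≤r)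

fromNCTree : ∀ n → NCTree (suc n) → TernaryOfSize n
fromNCTree n (nctree M _) =
  decode n (entry M) 0 n ,
  trans (sym (end-0 _)) (end-decode n (entry M) 0 n z≤n (≤-reflexive (sym (+-identityʳ n))))

fromNCTree-toNCTree : ∀ n (t : TernaryOfSize n) → fromNCTree n (toNCTree n t) ≡ t
fromNCTree-toNCTree _ (t , refl) =
  TernaryOfSize-≡ (trans (cong (decode (size t) _ 0) (sym (end-0 t)))
    (decode-edges _ t 0 (size t) (≤-reflexive (trans (end-0 t) (sym (+-identityʳ _))))
      λ x y (_ , x≤r) (_ , y≤r) → entry-matrix _ (edges t 0) (s≤s (subst (_ ≤_) (end-0 t) x≤r)) (s≤s (subst (_ ≤_) (end-0 t) y≤r))))

toNCTree-fromNCTree : ∀ n (T : NCTree (suc n)) → toNCTree n (fromNCTree n T) ≡ T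
toNCTree-fromNCTree n (nctree M p) =
  adjacency-≡ (recompute (≡-dec (≡-dec _≟B_) _ M) (FromMatrix.matrix-decode n M p))
  where
  adjacency-≡ : ∀ {m} {A B : Vec (Vec Bool m) m} .{p : IsNCTree m A} .{q : IsNCTree m B} → A ≡ B → nctree A p ≡ nctree B q
  adjacency-≡ refl = refl

ternary↔nctree : ∀ n → TernaryOfSize n ↔ NCTree (suc n)
ternary↔nctree n = mk↔ₛ′ (toNCTree n) (fromNCTree n) (toNCTree-fromNCTree n) (fromNCTree-toNCTree n)

-- Coloured Dyck paths

data FromHeight : ℕ → List Step → Set where
  done : FromHeight 0 []
  up   : ∀ {h w} → FromHeight (suc h) w → FromHeight h (U ∷ w)
  down : ∀ {h w} → FromHeight h w → FromHeight (suc h) (D ∷ w)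

fromHeight? : ∀ h w → Dec (FromHeight h w)
fromHeight? zero [] = yes done
fromHeight? (suc h) [] = no λ ()
fromHeight? h (U ∷ w) = map′ up (λ { (up p) → p }) (fromHeight? (suc h) w)
fromHeight? zero (D ∷ w) = no λ ()
fromHeight? (suc h) (D ∷ w) = map′ down (λ { (down p) → p }) (fromHeight? h w)

prefixes⇒FromHeight : ∀ h w → (∀ k → countD (take k w) ≤ h + countU (take k w)) → countD w ≡ h + countU w →
                      FromHeight h w
prefixes⇒FromHeight zero [] _ _ = done
prefixes⇒FromHeight (suc h) [] _ ()
prefixes⇒FromHeight h (U ∷ w) prefixes balanced =
  up (prefixes⇒FromHeight (suc h) w (λ k → ≤-trans (prefixes (suc k)) (≤-reflexive (+-suc h _)))
                                     (trans balanced (+-suc h (countU w))))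
prefixes⇒FromHeight zero (D ∷ w) prefixes _ with prefixes 1
... | ()
prefixes⇒FromHeight (suc h) (D ∷ w) prefixes balanced =
  down (prefixes⇒FromHeight h w (λ k → ≤-pred (prefixes (suc k))) (suc-injective balanced))

IsDyck⇒FromHeight : ∀ {n w} → IsDyck n w → FromHeight 0 w
IsDyck⇒FromHeight {w = w} d = prefixes⇒FromHeight 0 w (IsDyck.prefixes d) (trans (IsDyck.#D d) (sym (IsDyck.#U d)))

FromHeight-countD : ∀ {h w} → FromHeight h w → countD w ≡ h + countU w
FromHeight-countD done = refl
FromHeight-countD {h} (up {w = w} p) = trans (FromHeight-countD p) (sym (+-suc h (countU w)))
FromHeight-countD (down p) = cong suc (FromHeight-countD p)

FromHeight-prefixes : ∀ {h w} → FromHeight h w → ∀ k → countD (take k w) ≤ h + countU (take k w)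
FromHeight-prefixes p zero = z≤n
FromHeight-prefixes done (suc k) = z≤n
FromHeight-prefixes {h} (up p) (suc k) = ≤-trans (FromHeight-prefixes p k) (≤-reflexive (sym (+-suc h _)))
FromHeight-prefixes (down p) (suc k) = s≤s (FromHeight-prefixes p k)

FromHeight⇒IsDyck : ∀ {w} → FromHeight 0 w → IsDyck (countU w) w
FromHeight⇒IsDyck p = record { #U = refl ; #D = FromHeight-countD p ; prefixes = FromHeight-prefixes p }

FromHeight-ups : ∀ k {h} w → FromHeight (k + h) w → FromHeight h (replicate k U ++ w)
FromHeight-ups zero w p = p
FromHeight-ups (suc k) {h} w p = up (FromHeight-ups k w (subst (λ z → FromHeight z w) (sym (+-suc k h)) p))

countU-++ : ∀ u w → countU (u ++ w) ≡ countU u + countU w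
countU-++ [] w = refl
countU-++ (U ∷ u) w = cong suc (countU-++ u w)
countU-++ (D ∷ u) w = countU-++ u w

countU-ups : ∀ k w → countU (replicate k U ++ w) ≡ k + countU w
countU-ups zero w = refl
countU-ups (suc k) w = cong suc (countU-ups k w)

ascentsFrom-ups : ∀ j k w → ascentsFrom k (replicate j U ++ w) ≡ ascentsFrom (j + k) w
ascentsFrom-ups zero k w = refl
ascentsFrom-ups (suc j) zero w = trans (ascentsFrom-ups j 1 w) (cong (λ z → ascentsFrom z w) (+-suc j 0))
ascentsFrom-ups (suc j) (suc k) w = trans (ascentsFrom-ups j (suc (suc k)) w) (cong (λ z → ascentsFrom z w) (+-suc j (suc k)))

replicate-U-snoc : ∀ k (w : List Step) → replicate (suc k) U ++ w ≡ replicate k U ++ U ∷ w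
replicate-U-snoc zero w = refl
replicate-U-snoc (suc k) w = cong (U ∷_) (replicate-U-snoc k w)

++-assoc₃ : ∀ {A : Set} (xs ys zs ws : List A) → (xs ++ ys ++ zs) ++ ws ≡ xs ++ ys ++ zs ++ ws
++-assoc₃ xs ys zs ws = trans (++-assoc xs (ys ++ zs) ws) (cong (xs ++_) (++-assoc ys zs ws))

-- The spine of node d l r runs through l and r; every spine node carries its d.  The word
-- of a tree is U^k, k the spine size, followed by D w for the word w of each decoration, and
-- the first ascent is coloured by the Dyck word of the spine.
spineSize : Ternary → ℕ
spineSize leaf = 0
spineSize (node d l r) = suc (spineSize l + spineSize r)

spineWord : Ternary → List Step
spineWord leaf = []
spineWord (node d l r) = U ∷ spineWord l ++ D ∷ spineWord r

decorations : Ternary → List Ternary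
decorations leaf = []
decorations (node d l r) = decorations r ++ decorations l ++ d ∷ []

mutual
  toWord : Ternary → List Step
  toWord leaf = []
  toWord (node d l r) = replicate (spineSize (node d l r)) U ++ tailWord (node d l r)

  tailWord : Ternary → List Step
  tailWord leaf = []
  tailWord (node d l r) = tailWord r ++ tailWord l ++ D ∷ toWord d

mutual
  colours : Ternary → List (List Step)
  colours leaf = []
  colours (node d l r) = spineWord (node d l r) ∷ tailColours (node d l r)

  tailColours : Ternary → List (List Step)
  tailColours leaf = []
  tailColours (node d l r) = tailColours r ++ tailColours l ++ colours d

mutual
  treeAscents : Ternary → List ℕ
  treeAscents leaf = []
  treeAscents (node d l r) = spineSize (node d l r) ∷ tailAscents (node d l r)

  tailAscents : Ternary → List ℕ
  tailAscents leaf = []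
  tailAscents (node d l r) = tailAscents r ++ tailAscents l ++ treeAscents d

toWordsD : List Ternary → List Step
toWordsD [] = []
toWordsD (t ∷ ts) = D ∷ toWord t ++ toWordsD ts

toWords : List Ternary → List Step
toWords [] = []
toWords (t ∷ ts) = toWord t ++ toWordsD ts

coloursAll : List Ternary → List (List Step)
coloursAll [] = []
coloursAll (t ∷ ts) = colours t ++ coloursAll ts

toWordsD-++ : ∀ ts us → toWordsD (ts ++ us) ≡ toWordsD ts ++ toWordsD us
toWordsD-++ [] us = refl
toWordsD-++ (t ∷ ts) us = cong (D ∷_) (trans (cong (toWord t ++_) (toWordsD-++ ts us)) (sym (++-assoc (toWord t) _ _)))

coloursAll-++ : ∀ ts us → coloursAll (ts ++ us) ≡ coloursAll ts ++ coloursAll us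
coloursAll-++ [] us = refl
coloursAll-++ (t ∷ ts) us = trans (cong (colours t ++_) (coloursAll-++ ts us)) (sym (++-assoc (colours t) _ _))

toWordsD-nonempty : ∀ ts → 1 ≤ length ts → toWordsD ts ≡ D ∷ toWords ts
toWordsD-nonempty (t ∷ ts) _ = refl

tailWord-decorations : ∀ t → tailWord t ≡ toWordsD (decorations t)
tailWord-decorations leaf = refl
tailWord-decorations (node d l r) = sym (begin
  toWordsD (decorations r ++ decorations l ++ d ∷ [])           ≡⟨ toWordsD-++ (decorations r) _ ⟩
  toWordsD (decorations r) ++ toWordsD (decorations l ++ d ∷ []) ≡⟨ cong (_ ++_) (toWordsD-++ (decorations l) _) ⟩
  toWordsD (decorations r) ++ toWordsD (decorations l) ++ D ∷ toWord d ++ []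
    ≡⟨ cong₂ _++_ (sym (tailWord-decorations r)) (cong₂ _++_ (sym (tailWord-decorations l)) (cong (D ∷_) (++-identityʳ _))) ⟩
  tailWord r ++ tailWord l ++ D ∷ toWord d                         ∎)
  where open ≡-Reasoning

tailColours-decorations : ∀ t → tailColours t ≡ coloursAll (decorations t)
tailColours-decorations leaf = refl
tailColours-decorations (node d l r) = sym (begin
  coloursAll (decorations r ++ decorations l ++ d ∷ [])             ≡⟨ coloursAll-++ (decorations r) _ ⟩
  coloursAll (decorations r) ++ coloursAll (decorations l ++ d ∷ []) ≡⟨ cong (_ ++_) (coloursAll-++ (decorations l) _) ⟩
  coloursAll (decorations r) ++ coloursAll (decorations l) ++ colours d ++ []
    ≡⟨ cong₂ _++_ (sym (tailColours-decorations r)) (cong₂ _++_ (sym (tailColours-decorations l)) (++-identityʳ _)) ⟩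
  tailColours r ++ tailColours l ++ colours d                          ∎)
  where open ≡-Reasoning

NoLeadingU : List Step → Set
NoLeadingU [] = ⊤
NoLeadingU (U ∷ _) = ⊥
NoLeadingU (D ∷ _) = ⊤

tailWord-NoLeadingU : ∀ t rest → NoLeadingU rest → NoLeadingU (tailWord t ++ rest)
tailWord-NoLeadingU t rest no-U rewrite tailWord-decorations t with decorations t
... | [] = no-U
... | _ ∷ _ = tt

tailWord-++-D : ∀ t u → ∃ λ w → tailWord t ++ D ∷ u ≡ D ∷ w
tailWord-++-D leaf u = u , refl
tailWord-++-D (node d l r) u =
  let (w₁ , eq₁) = tailWord-++-D l (toWord d ++ D ∷ u)
      (w₂ , eq₂) = tailWord-++-D r w₁ in
  w₂ , trans (++-assoc₃ (tailWord r) (tailWord l) (D ∷ toWord d) (D ∷ u)) (trans (cong (tailWord r ++_) eq₁) eq₂)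

tailWord-node : ∀ d l r rest → ∃ λ w → tailWord (node d l r) ++ rest ≡ D ∷ w
tailWord-node d l r rest =
  let (w₁ , eq₁) = tailWord-++-D l (toWord d ++ rest)
      (w₂ , eq₂) = tailWord-++-D r w₁ in
  w₂ , trans (++-assoc₃ (tailWord r) (tailWord l) (D ∷ toWord d) rest) (trans (cong (tailWord r ++_) eq₁) eq₂)

FromHeight-spineWord : ∀ t h rest → FromHeight h rest → FromHeight h (spineWord t ++ rest)
FromHeight-spineWord leaf h rest p = p
FromHeight-spineWord (node d l r) h rest p =
  up (subst (FromHeight (suc h)) (sym (++-assoc (spineWord l) (D ∷ spineWord r) rest))
            (FromHeight-spineWord l (suc h) _ (down (FromHeight-spineWord r h rest p))))

mutual
  FromHeight-toWord : ∀ t h rest → FromHeight h rest → FromHeight h (toWord t ++ rest)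
  FromHeight-toWord leaf h rest p = p
  FromHeight-toWord t@(node d l r) h rest p =
    subst (FromHeight h) (sym (++-assoc (replicate (spineSize t) U) (tailWord t) rest))
          (FromHeight-ups (spineSize t) _ (FromHeight-tailWord t h rest p))

  FromHeight-tailWord : ∀ t h rest → FromHeight h rest → FromHeight (spineSize t + h) (tailWord t ++ rest)
  FromHeight-tailWord leaf h rest p = p
  FromHeight-tailWord (node d l r) h rest p =
    subst₂ FromHeight (+-reassoc (spineSize l) (spineSize r) h) (sym (++-assoc₃ (tailWord r) (tailWord l) (D ∷ toWord d) rest))
      (FromHeight-tailWord r _ _ (FromHeight-tailWord l (suc h) _ (down (FromHeight-toWord d h rest p))))
    where
    +-reassoc : ∀ a b h → b + (a + suc h) ≡ suc (a + b) + h
    +-reassoc = solve-∀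

tailSize : Ternary → ℕ
tailSize leaf = 0
tailSize (node d l r) = tailSize r + tailSize l + size d

size-spineSize : ∀ t → size t ≡ spineSize t + tailSize t
size-spineSize leaf = refl
size-spineSize (node d l r) rewrite size-spineSize l | size-spineSize r =
  +-reassoc (size d) (spineSize l) (tailSize l) (spineSize r) (tailSize r)
  where
  +-reassoc : ∀ e a b c f → suc (e + (a + b) + (c + f)) ≡ suc (a + c) + (f + b + e)
  +-reassoc = solve-∀

countU-spineWord : ∀ t → countU (spineWord t) ≡ spineSize t
countU-spineWord leaf = refl
countU-spineWord (node d l r) =
  cong suc (trans (countU-++ (spineWord l) (D ∷ spineWord r)) (cong₂ _+_ (countU-spineWord l) (countU-spineWord r)))

mutual
  countU-toWord : ∀ t → countU (toWord t) ≡ size t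
  countU-toWord leaf = refl
  countU-toWord t@(node d l r) =
    trans (countU-ups (spineSize t) (tailWord t))
          (trans (cong (spineSize t +_) (countU-tailWord t)) (sym (size-spineSize t)))

  countU-tailWord : ∀ t → countU (tailWord t) ≡ tailSize t
  countU-tailWord leaf = refl
  countU-tailWord (node d l r) = begin
    countU (tailWord r ++ tailWord l ++ D ∷ toWord d)                 ≡⟨ countU-++ (tailWord r) _ ⟩
    countU (tailWord r) + countU (tailWord l ++ D ∷ toWord d)         ≡⟨ cong (countU (tailWord r) +_) (countU-++ (tailWord l) _) ⟩
    countU (tailWord r) + (countU (tailWord l) + countU (toWord d))
      ≡⟨ cong₂ _+_ (countU-tailWord r) (cong₂ _+_ (countU-tailWord l) (countU-toWord d)) ⟩
    tailSize r + (tailSize l + size d)                                 ≡⟨ sym (+-assoc (tailSize r) _ _) ⟩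
    tailSize r + tailSize l + size d                                   ∎
    where open ≡-Reasoning

mutual
  ascents-toWord : ∀ t rest → NoLeadingU rest → ascentsFrom 0 (toWord t ++ rest) ≡ treeAscents t ++ ascentsFrom 0 rest
  ascents-toWord leaf rest no-U = refl
  ascents-toWord t@(node d l r) rest no-U = from-first-ascent (tailWord-node d l r rest) (ascents-tailWord t rest no-U)
    where
    open ≡-Reasoning
    from-first-ascent : ∃ (λ w → tailWord t ++ rest ≡ D ∷ w) →
                        ascentsFrom 0 (tailWord t ++ rest) ≡ tailAscents t ++ ascentsFrom 0 rest →
                        ascentsFrom 0 (toWord t ++ rest) ≡ treeAscents t ++ ascentsFrom 0 rest
    from-first-ascent (w , starts-D) ascents-tail = begin
      ascentsFrom 0 ((replicate (spineSize t) U ++ tailWord t) ++ rest)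
        ≡⟨ cong (ascentsFrom 0) (++-assoc (replicate (spineSize t) U) (tailWord t) rest) ⟩
      ascentsFrom 0 (replicate (spineSize t) U ++ tailWord t ++ rest)
        ≡⟨ trans (ascentsFrom-ups (spineSize t) 0 _) (cong (λ k → ascentsFrom k (tailWord t ++ rest)) (+-identityʳ (spineSize t))) ⟩
      ascentsFrom (spineSize t) (tailWord t ++ rest)
        ≡⟨ cong (ascentsFrom (spineSize t)) starts-D ⟩
      spineSize t ∷ ascentsFrom 0 w
        ≡⟨ cong (spineSize t ∷_) (trans (cong (ascentsFrom 0) (sym starts-D)) ascents-tail) ⟩
      spineSize t ∷ tailAscents t ++ ascentsFrom 0 rest ∎

  ascents-tailWord : ∀ t rest → NoLeadingU rest → ascentsFrom 0 (tailWord t ++ rest) ≡ tailAscents t ++ ascentsFrom 0 rest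
  ascents-tailWord leaf rest no-U = refl
  ascents-tailWord (node d l r) rest no-U = begin
    ascentsFrom 0 ((tailWord r ++ tailWord l ++ D ∷ toWord d) ++ rest)
      ≡⟨ cong (ascentsFrom 0) (++-assoc₃ (tailWord r) (tailWord l) (D ∷ toWord d) rest) ⟩
    ascentsFrom 0 (tailWord r ++ tailWord l ++ D ∷ toWord d ++ rest)
      ≡⟨ ascents-tailWord r _ (tailWord-NoLeadingU l _ tt) ⟩
    tailAscents r ++ ascentsFrom 0 (tailWord l ++ D ∷ toWord d ++ rest)
      ≡⟨ cong (tailAscents r ++_) (ascents-tailWord l _ tt) ⟩
    tailAscents r ++ tailAscents l ++ ascentsFrom 0 (toWord d ++ rest)
      ≡⟨ cong (λ z → tailAscents r ++ tailAscents l ++ z) (ascents-toWord d rest no-U) ⟩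
    tailAscents r ++ tailAscents l ++ treeAscents d ++ ascentsFrom 0 rest
      ≡⟨ sym (++-assoc₃ (tailAscents r) (tailAscents l) (treeAscents d) _) ⟩
    (tailAscents r ++ tailAscents l ++ treeAscents d) ++ ascentsFrom 0 rest ∎
    where open ≡-Reasoning

data Colouring : List ℕ → List (List Step) → Set where
  []  : Colouring [] []
  _∷_ : ∀ {k c ks cs} → FromHeight 0 c × countU c ≡ k → Colouring ks cs → Colouring (k ∷ ks) (c ∷ cs)

Colouring-++ : ∀ {ks cs ks′ cs′} → Colouring ks cs → Colouring ks′ cs′ → Colouring (ks ++ ks′) (cs ++ cs′)
Colouring-++ [] col′ = col′
Colouring-++ (c ∷ col) col′ = c ∷ Colouring-++ col col′

mutual
  colours-Colouring : ∀ t → Colouring (treeAscents t) (colours t)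
  colours-Colouring leaf = []
  colours-Colouring t@(node d l r) =
    (subst (FromHeight 0) (++-identityʳ (spineWord t)) (FromHeight-spineWord t 0 [] done) , countU-spineWord t)
    ∷ tailColours-Colouring t

  tailColours-Colouring : ∀ t → Colouring (tailAscents t) (tailColours t)
  tailColours-Colouring leaf = []
  tailColours-Colouring (node d l r) =
    Colouring-++ (tailColours-Colouring r) (Colouring-++ (tailColours-Colouring l) (colours-Colouring d))

-- parse reads a word from the right, keeping the trees of the suffix read so far in a list.
-- At the D that ends an ascent, the colour c of the ascent is read by parseSpine, which
-- builds the spine described by c and takes its decorations from the front of that list.
graft : List Ternary × List Ternary → List Ternary × List Ternary
graft (l ∷ r ∷ spines , d ∷ ts) = node d l r ∷ spines , ts
graft _ = [] , []

parseSpine : List Step → List Ternary → List Ternary × List Ternary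
parseSpine [] ts = leaf ∷ [] , ts
parseSpine (D ∷ c) ts = leaf ∷ proj₁ (parseSpine c ts) , proj₂ (parseSpine c ts)
parseSpine (U ∷ c) ts = graft (parseSpine c ts)

headOrLeaf : List Ternary → Ternary
headOrLeaf [] = leaf
headOrLeaf (t ∷ _) = t

tail : List Ternary → List Ternary
tail [] = []
tail (_ ∷ ts) = ts

parse : ℕ → List Step → List (List Step) → List Ternary
parse zero [] cs = leaf ∷ []
parse (suc k) [] cs = []
parse k (U ∷ w) cs = parse (suc k) w cs
parse zero (D ∷ w) cs = leaf ∷ parse zero w cs
parse (suc k) (D ∷ w) [] = []
parse (suc k) (D ∷ w) (c ∷ cs) = headOrLeaf (proj₁ (parseSpine c (parse zero w cs))) ∷ proj₂ (parseSpine c (parse zero w cs))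

plug : Ternary → Ternary → Ternary
plug leaf s = s
plug (node d l r) s = node d l (plug r s)

plug-leaf : ∀ t → plug t leaf ≡ t
plug-leaf leaf = refl
plug-leaf (node d l r) = cong (node d l) (plug-leaf r)

parseSpine-spineWord : ∀ t rest ts s spines ts′ → parseSpine rest ts ≡ (s ∷ spines , decorations t ++ ts′) →
                       parseSpine (spineWord t ++ rest) ts ≡ (plug t s ∷ spines , ts′)
parseSpine-spineWord leaf rest ts s spines ts′ e = e
parseSpine-spineWord (node d l r) rest ts s spines ts′ e =
  trans (cong (λ z → graft (parseSpine z ts)) (++-assoc (spineWord l) (D ∷ spineWord r) rest))
        (trans (cong graft (parseSpine-spineWord l _ ts leaf (plug r s ∷ spines) (d ∷ ts′) after-r))
               (cong (λ z → node d z (plug r s) ∷ spines , ts′) (plug-leaf l)))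
  where
  after-r : parseSpine (D ∷ spineWord r ++ rest) ts ≡ (leaf ∷ plug r s ∷ spines , decorations l ++ d ∷ ts′)
  after-r = cong (λ p → leaf ∷ proj₁ p , proj₂ p)
    (parseSpine-spineWord r rest ts s spines (decorations l ++ d ∷ ts′)
      (trans e (cong (s ∷ spines ,_) (++-assoc₃ (decorations r) (decorations l) (d ∷ []) ts′))))

parseSpine-spineWord-decorations : ∀ t ts → parseSpine (spineWord t) (decorations t ++ ts) ≡ (t ∷ [] , ts)
parseSpine-spineWord-decorations t ts =
  trans (cong (λ z → parseSpine z (decorations t ++ ts)) (sym (++-identityʳ (spineWord t))))
        (trans (parseSpine-spineWord t [] (decorations t ++ ts) leaf [] ts refl) (cong (λ z → z ∷ [] , ts) (plug-leaf t)))

parse-NoLeadingU : ∀ rest cs → NoLeadingU rest → parse 0 rest cs ≡ leaf ∷ tail (parse 0 rest cs)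
parse-NoLeadingU [] cs _ = refl
parse-NoLeadingU (D ∷ w) cs _ = refl

parse-ups : ∀ j k w cs → parse k (replicate j U ++ w) cs ≡ parse (j + k) w cs
parse-ups zero k w cs = refl
parse-ups (suc j) zero w cs = trans (parse-ups j 1 w cs) (cong (λ z → parse z w cs) (+-suc j 0))
parse-ups (suc j) (suc k) w cs = trans (parse-ups j (suc (suc k)) w cs) (cong (λ z → parse z w cs) (+-suc j (suc k)))

parse-toWord-node : ∀ d l r rest cs →
  parse 0 (tailWord (node d l r) ++ rest) (tailColours (node d l r) ++ cs) ≡ leaf ∷ decorations (node d l r) ++ tail (parse 0 rest cs) →
  parse 0 (toWord (node d l r) ++ rest) (colours (node d l r) ++ cs) ≡ node d l r ∷ tail (parse 0 rest cs)
parse-toWord-node d l r rest cs parse-tail with tailWord-node d l r rest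
... | w , starts-D = begin
  parse 0 ((replicate (spineSize t) U ++ tailWord t) ++ rest) (colours t ++ cs)
    ≡⟨ cong (λ z → parse 0 z (colours t ++ cs)) (++-assoc (replicate (spineSize t) U) (tailWord t) rest) ⟩
  parse 0 (replicate (spineSize t) U ++ tailWord t ++ rest) (colours t ++ cs)
    ≡⟨ trans (parse-ups (spineSize t) 0 _ _) (cong (λ k → parse k (tailWord t ++ rest) (colours t ++ cs)) (+-identityʳ (spineSize t))) ⟩
  parse (spineSize t) (tailWord t ++ rest) (colours t ++ cs)
    ≡⟨ cong (λ z → parse (spineSize t) z (colours t ++ cs)) starts-D ⟩
  headOrLeaf (proj₁ (parseSpine (spineWord t) (parse 0 w (tailColours t ++ cs)))) ∷ proj₂ (parseSpine (spineWord t) (parse 0 w (tailColours t ++ cs)))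
    ≡⟨ cong (λ ts → headOrLeaf (proj₁ (parseSpine (spineWord t) ts)) ∷ proj₂ (parseSpine (spineWord t) ts)) parse-w ⟩
  headOrLeaf (proj₁ (parseSpine (spineWord t) (decorations t ++ _))) ∷ proj₂ (parseSpine (spineWord t) (decorations t ++ _))
    ≡⟨ cong (λ p → headOrLeaf (proj₁ p) ∷ proj₂ p) (parseSpine-spineWord-decorations t _) ⟩
  t ∷ tail (parse 0 rest cs) ∎
  where
  open ≡-Reasoning
  t = node d l r
  parse-w : parse 0 w (tailColours t ++ cs) ≡ decorations t ++ tail (parse 0 rest cs)
  parse-w = ∷-injectiveʳ (trans (cong (λ z → parse 0 z (tailColours t ++ cs)) (sym starts-D)) parse-tail)

mutual
  parse-toWord : ∀ t rest cs → NoLeadingU rest → parse 0 (toWord t ++ rest) (colours t ++ cs) ≡ t ∷ tail (parse 0 rest cs)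
  parse-toWord leaf rest cs no-U = parse-NoLeadingU rest cs no-U
  parse-toWord (node d l r) rest cs no-U = parse-toWord-node d l r rest cs (parse-tailWord (node d l r) rest cs no-U)

  parse-tailWord : ∀ t rest cs → NoLeadingU rest →
                   parse 0 (tailWord t ++ rest) (tailColours t ++ cs) ≡ leaf ∷ decorations t ++ tail (parse 0 rest cs)
  parse-tailWord leaf rest cs no-U = parse-NoLeadingU rest cs no-U
  parse-tailWord (node d l r) rest cs no-U = begin
    parse 0 ((tailWord r ++ tailWord l ++ D ∷ toWord d) ++ rest) ((tailColours r ++ tailColours l ++ colours d) ++ cs)
      ≡⟨ cong₂ (parse 0) (++-assoc₃ (tailWord r) (tailWord l) (D ∷ toWord d) rest) (++-assoc₃ (tailColours r) (tailColours l) (colours d) cs) ⟩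
    parse 0 (tailWord r ++ tailWord l ++ D ∷ toWord d ++ rest) (tailColours r ++ tailColours l ++ colours d ++ cs)
      ≡⟨ parse-tailWord r _ _ (tailWord-NoLeadingU l _ tt) ⟩
    leaf ∷ decorations r ++ tail (parse 0 (tailWord l ++ D ∷ toWord d ++ rest) (tailColours l ++ colours d ++ cs))
      ≡⟨ cong (λ z → leaf ∷ decorations r ++ tail z) (parse-tailWord l _ _ tt) ⟩
    leaf ∷ decorations r ++ decorations l ++ parse 0 (toWord d ++ rest) (colours d ++ cs)
      ≡⟨ cong (λ z → leaf ∷ decorations r ++ decorations l ++ z) (parse-toWord d rest cs no-U) ⟩
    leaf ∷ decorations r ++ decorations l ++ d ∷ tail (parse 0 rest cs)
      ≡⟨ cong (leaf ∷_) (sym (++-assoc₃ (decorations r) (decorations l) (d ∷ []) _)) ⟩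
    leaf ∷ (decorations r ++ decorations l ++ d ∷ []) ++ tail (parse 0 rest cs) ∎
    where open ≡-Reasoning

spineWordsD : List Ternary → List Step
spineWordsD [] = []
spineWordsD (t ∷ ts) = D ∷ spineWord t ++ spineWordsD ts

spineWords : List Ternary → List Step
spineWords [] = []
spineWords (t ∷ ts) = spineWord t ++ spineWordsD ts

decorationsAll : List Ternary → List Ternary
decorationsAll [] = []
decorationsAll (t ∷ ts) = decorationsAll ts ++ decorations t

length-decorations : ∀ t → length (decorations t) ≡ spineSize t
length-decorations leaf = refl
length-decorations (node d l r) = begin
  length (decorations r ++ decorations l ++ d ∷ [])                ≡⟨ length-++ (decorations r) ⟩
  length (decorations r) + length (decorations l ++ d ∷ [])        ≡⟨ cong (length (decorations r) +_) (length-++ (decorations l)) ⟩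
  length (decorations r) + (length (decorations l) + 1)            ≡⟨ cong₂ (λ a b → a + (b + 1)) (length-decorations r) (length-decorations l) ⟩
  spineSize r + (spineSize l + 1)                                  ≡⟨ +-reassoc (spineSize l) (spineSize r) ⟩
  suc (spineSize l + spineSize r)                                  ∎
  where
  open ≡-Reasoning
  +-reassoc : ∀ a b → b + (a + 1) ≡ suc (a + b)
  +-reassoc = solve-∀

length-decorationsAll : ∀ ts → length (decorationsAll ts) ≡ countU (spineWords ts)
length-decorationsAll [] = refl
length-decorationsAll (t ∷ ts) = begin
  length (decorationsAll ts ++ decorations t)           ≡⟨ length-++ (decorationsAll ts) ⟩
  length (decorationsAll ts) + length (decorations t)   ≡⟨ cong₂ _+_ (length-decorationsAll ts) (length-decorations t) ⟩
  countU (spineWords ts) + spineSize t                  ≡⟨ cong (_+ spineSize t) (countU-spineWordsD ts) ⟩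
  countU (spineWordsD ts) + spineSize t                 ≡⟨ +-comm _ (spineSize t) ⟩
  spineSize t + countU (spineWordsD ts)                 ≡⟨ cong (_+ countU (spineWordsD ts)) (sym (countU-spineWord t)) ⟩
  countU (spineWord t) + countU (spineWordsD ts)        ≡⟨ sym (countU-++ (spineWord t) _) ⟩
  countU (spineWord t ++ spineWordsD ts)                ∎
  where
  open ≡-Reasoning
  countU-spineWordsD : ∀ ts → countU (spineWords ts) ≡ countU (spineWordsD ts)
  countU-spineWordsD [] = refl
  countU-spineWordsD (_ ∷ _) = refl

ParsesSpine : ℕ → List Step → List Ternary → List Ternary × List Ternary → Set
ParsesSpine h c ts (spines , ts′) = length spines ≡ suc h × spineWords spines ≡ c × decorationsAll spines ++ ts′ ≡ ts

parseSpine-parses : ∀ {h c} → FromHeight h c → ∀ ts → countU c ≤ length ts → ParsesSpine h c ts (parseSpine c ts)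
parseSpine-parses done ts _ = refl , refl , refl
parseSpine-parses (down {w = c} p) ts c≤ with parseSpine c ts | parseSpine-parses p ts c≤
... | s ∷ spines , ts′ | len , spells , decs =
  cong suc len , cong (D ∷_) spells , trans (cong (_++ ts′) (++-identityʳ (decorationsAll (s ∷ spines)))) decs
parseSpine-parses (up {h} {c} p) ts 1+c≤ with parseSpine c ts | parseSpine-parses p ts (≤-trans (n≤1+n _) 1+c≤)
... | l ∷ r ∷ spines , d ∷ ts′ | len , spells , decs =
  suc-injective len ,
  cong (U ∷_) (trans (++-assoc (spineWord l) (D ∷ spineWord r) (spineWordsD spines)) spells) ,
  trans (reassoc (decorationsAll spines) (decorations r) (decorations l) d ts′) decs
  where
  reassoc : ∀ (as bs cs : List Ternary) d ts → (as ++ bs ++ cs ++ d ∷ []) ++ ts ≡ ((as ++ bs) ++ cs) ++ d ∷ ts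
  reassoc as bs cs d ts rewrite ++-assoc as bs cs | ++-assoc as (bs ++ cs) (d ∷ ts) | ++-assoc bs cs (d ∷ ts)
                              | ++-assoc as (bs ++ cs ++ d ∷ []) ts | ++-assoc bs (cs ++ d ∷ []) ts | ++-assoc cs (d ∷ []) ts = refl
... | l ∷ r ∷ spines , [] | _ , spells , decs = ⊥-elim (<⇒≱ 1+c≤ (≤-reflexive length-ts))
  where
  length-ts : length ts ≡ countU c
  length-ts = begin
    length ts                                           ≡⟨ cong length (sym decs) ⟩
    length (decorationsAll (l ∷ r ∷ spines) ++ [])      ≡⟨ cong length (++-identityʳ (decorationsAll (l ∷ r ∷ spines))) ⟩
    length (decorationsAll (l ∷ r ∷ spines))            ≡⟨ length-decorationsAll (l ∷ r ∷ spines) ⟩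
    countU (spineWords (l ∷ r ∷ spines))                ≡⟨ cong countU spells ⟩
    countU c                                            ∎
    where open ≡-Reasoning
... | [] , _ | () , _
... | _ ∷ [] , _ | () , _

Spells : ℕ → ℕ → List Step → List (List Step) → List Ternary → Set
Spells h k w cs ts = length ts ≡ suc h × toWords ts ≡ replicate k U ++ w × coloursAll ts ≡ cs

toWord-++-toWordsD : ∀ t ts → toWord t ++ toWordsD ts ≡ replicate (spineSize t) U ++ toWordsD (decorations t ++ ts)
toWord-++-toWordsD leaf ts = refl
toWord-++-toWordsD t@(node d l r) ts = begin
  (replicate (spineSize t) U ++ tailWord t) ++ toWordsD ts        ≡⟨ ++-assoc (replicate (spineSize t) U) (tailWord t) _ ⟩
  replicate (spineSize t) U ++ tailWord t ++ toWordsD ts          ≡⟨ cong (λ z → replicate (spineSize t) U ++ z ++ toWordsD ts) (tailWord-decorations t) ⟩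
  replicate (spineSize t) U ++ toWordsD (decorations t) ++ toWordsD ts ≡⟨ cong (replicate (spineSize t) U ++_) (sym (toWordsD-++ (decorations t) ts)) ⟩
  replicate (spineSize t) U ++ toWordsD (decorations t ++ ts)     ∎
  where open ≡-Reasoning

tailColours-++-coloursAll : ∀ t ts → tailColours t ++ coloursAll ts ≡ coloursAll (decorations t ++ ts)
tailColours-++-coloursAll t ts =
  trans (cong (_++ coloursAll ts) (tailColours-decorations t)) (sym (coloursAll-++ (decorations t) ts))

close-ascent : ∀ {h k w c cs} ts → Spells (k + h) 0 w cs ts → FromHeight 0 c → countU c ≡ suc k →
               Spells h (suc k) (D ∷ w) (c ∷ cs) (headOrLeaf (proj₁ (parseSpine c ts)) ∷ proj₂ (parseSpine c ts))
close-ascent {h} {k} {w} {c} {cs} ts (len , spells , cols) c-dyck #U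
  with parseSpine c ts | parseSpine-parses c-dyck ts (subst₂ _≤_ (sym #U) (sym len) (s≤s (m≤m+n k h)))
... | leaf ∷ [] , _ | _ , spine-spells , _ = ⊥-elim (0≢1+n (trans (cong countU spine-spells) #U))
... | t@(node d l r) ∷ [] , ts′ | _ , spine-spells , decs =
  cong suc (+-cancelˡ-≡ (suc k) (length ts′) h length-ts′) ,
  trans (toWord-++-toWordsD t ts′)
        (cong₂ _++_ (cong (λ z → replicate z U) spine-k)
                    (trans (cong toWordsD decs) (trans (toWordsD-nonempty ts (subst (1 ≤_) (sym len) (s≤s z≤n))) (cong (D ∷_) spells)))) ,
  cong₂ _∷_ spine-c (trans (tailColours-++-coloursAll t ts′) (trans (cong coloursAll decs) cols))
  where
  spine-c : spineWord t ≡ c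
  spine-c = trans (sym (++-identityʳ (spineWord t))) spine-spells
  spine-k : spineSize t ≡ suc k
  spine-k = trans (sym (countU-spineWord t)) (trans (cong countU spine-c) #U)
  length-ts′ : suc k + length ts′ ≡ suc k + h
  length-ts′ = begin
    suc k + length ts′                            ≡⟨ cong (_+ length ts′) (sym (trans (length-decorations t) spine-k)) ⟩
    length (decorations t) + length ts′           ≡⟨ sym (length-++ (decorations t)) ⟩
    length (decorations t ++ ts′)                 ≡⟨ cong length decs ⟩
    length ts                                     ≡⟨ len ⟩
    suc (k + h)                                   ∎
    where open ≡-Reasoning
... | [] , _ | () , _
... | _ ∷ _ ∷ _ , _ | () , _

toWords-parse : ∀ w k h cs → FromHeight (k + h) w → Colouring (ascentsFrom k w) cs → Spells h k w cs (parse k w cs)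
toWords-parse [] zero zero [] done [] = refl , refl , refl
toWords-parse [] zero (suc h) cs () col
toWords-parse [] (suc k) h cs () col
toWords-parse (U ∷ w) zero h cs (up p) col = toWords-parse w 1 h cs p col
toWords-parse (U ∷ w) (suc k) h cs (up p) col =
  let (len , spells , cols) = toWords-parse w (suc (suc k)) h cs p col in
  len , trans spells (replicate-U-snoc (suc k) w) , cols
toWords-parse (D ∷ w) zero zero cs () col
toWords-parse (D ∷ w) zero (suc h) cs (down p) col =
  let (len , spells , cols) = toWords-parse w zero h cs p col in
  cong suc len , trans (toWordsD-nonempty (parse 0 w cs) (subst (1 ≤_) (sym len) (s≤s z≤n))) (cong (D ∷_) spells) , cols
toWords-parse (D ∷ w) (suc k) h [] (down p) ()
toWords-parse (D ∷ w) (suc k) h (c ∷ cs) (down p) ((c-dyck , #U) ∷ col) =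
  close-ascent (parse 0 w cs) (toWords-parse w zero (k + h) cs p col) c-dyck #U

parse-singleton : ∀ w cs → FromHeight 0 w → Colouring (ascents w) cs →
                  ∃ λ t → parse 0 w cs ≡ t ∷ [] × toWord t ≡ w × colours t ≡ cs
parse-singleton w cs w-dyck col with parse 0 w cs | toWords-parse w 0 0 cs w-dyck col
... | t ∷ [] | _ , spells , cols = t , refl , trans (sym (++-identityʳ (toWord t))) spells , trans (sym (++-identityʳ (colours t))) cols
... | [] | () , _
... | _ ∷ _ ∷ _ | () , _

colourWords : ∀ {ks} → All DyckPath ks → List (List Step)
colourWords [] = []
colourWords (p ∷ ps) = word p ∷ colourWords ps

toColours : ∀ ks cs → Colouring ks cs → All DyckPath ks
toColours [] [] [] = []
toColours (k ∷ ks) (c ∷ cs) ((c-dyck , #U) ∷ col) = dyck c (subst (λ n → IsDyck n c) #U (FromHeight⇒IsDyck c-dyck)) ∷ toColours ks cs col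

colourWords-toColours : ∀ ks cs (col : Colouring ks cs) → colourWords (toColours ks cs col) ≡ cs
colourWords-toColours [] [] [] = refl
colourWords-toColours (k ∷ ks) (c ∷ cs) (_ ∷ col) = cong (c ∷_) (colourWords-toColours ks cs col)

colourWords-injective : ∀ {ks} (ps qs : All DyckPath ks) → colourWords ps ≡ colourWords qs → ps ≡ qs
colourWords-injective [] [] _ = refl
colourWords-injective (dyck w _ ∷ ps) (dyck w′ _ ∷ qs) eq with ∷-injectiveˡ eq
... | refl = cong (_ ∷_) (colourWords-injective ps qs (∷-injectiveʳ eq))

colourWords-Colouring : ∀ {ks} (ps : All DyckPath ks) → Colouring ks (colourWords ps)
colourWords-Colouring [] = []
colourWords-Colouring {k ∷ _} (dyck c c-dyck ∷ ps) =
  (recompute (fromHeight? 0 c) (IsDyck⇒FromHeight c-dyck) , recompute (countU c ≟ k) (IsDyck.#U c-dyck)) ∷ colourWords-Colouring ps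

coloured-≡ : ∀ {n w w′} .(p : IsDyck n w) .(p′ : IsDyck n w′) (ps : All DyckPath (ascents w)) (ps′ : All DyckPath (ascents w′)) →
             w ≡ w′ → colourWords ps ≡ colourWords ps′ → coloured (dyck w p) ps ≡ coloured (dyck w′ p′) ps′
coloured-≡ p p′ ps ps′ refl eq = cong (coloured (dyck _ p)) (colourWords-injective ps ps′ eq)

toWord-Dyck : ∀ t → FromHeight 0 (toWord t)
toWord-Dyck t = subst (FromHeight 0) (++-identityʳ (toWord t)) (FromHeight-toWord t 0 [] done)

ascents-toWord-colours : ∀ t → Colouring (ascents (toWord t)) (colours t)
ascents-toWord-colours t = subst (λ ks → Colouring ks (colours t)) (sym ascents≡) (colours-Colouring t)
  where
  ascents≡ : ascents (toWord t) ≡ treeAscents t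
  ascents≡ = trans (cong ascents (sym (++-identityʳ (toWord t)))) (trans (ascents-toWord t [] tt) (++-identityʳ (treeAscents t)))

toColoured : ∀ n → TernaryOfSize n → ColouredDyckPath n
toColoured n (t , size≡n) =
  coloured (dyck (toWord t) (subst (λ k → IsDyck k (toWord t)) (trans (countU-toWord t) size≡n) (FromHeight⇒IsDyck (toWord-Dyck t))))
           (toColours _ (colours t) (ascents-toWord-colours t))

fromColoured : ∀ n → ColouredDyckPath n → TernaryOfSize n
fromColoured n (coloured (dyck w w-dyck) ps) = headOrLeaf (parse 0 w (colourWords ps)) , size≡n
  where
  size≡n : size (headOrLeaf (parse 0 w (colourWords ps))) ≡ n
  size≡n with parse-singleton w (colourWords ps) (recompute (fromHeight? 0 w) (IsDyck⇒FromHeight w-dyck)) (colourWords-Colouring ps)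
  ... | t , parsed , spells , _ rewrite parsed =
    trans (sym (countU-toWord t)) (trans (cong countU spells) (recompute (countU w ≟ n) (IsDyck.#U w-dyck)))

fromColoured-toColoured : ∀ n (t : TernaryOfSize n) → fromColoured n (toColoured n t) ≡ t
fromColoured-toColoured n (t , _) = TernaryOfSize-≡ (cong headOrLeaf (begin
  parse 0 (toWord t) (colourWords (toColours _ (colours t) _)) ≡⟨ cong (parse 0 (toWord t)) (colourWords-toColours _ (colours t) _) ⟩
  parse 0 (toWord t) (colours t)                               ≡⟨ cong₂ (parse 0) (sym (++-identityʳ (toWord t))) (sym (++-identityʳ (colours t))) ⟩
  parse 0 (toWord t ++ []) (colours t ++ [])                   ≡⟨ parse-toWord t [] [] tt ⟩
  t ∷ []                                                       ∎))
  where open ≡-Reasoning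

toColoured-fromColoured : ∀ n (P : ColouredDyckPath n) → toColoured n (fromColoured n P) ≡ P
toColoured-fromColoured n (coloured (dyck w w-dyck) ps)
  with parse-singleton w (colourWords ps) (recompute (fromHeight? 0 w) (IsDyck⇒FromHeight w-dyck)) (colourWords-Colouring ps)
... | t , parsed , spells , cols =
  coloured-≡ _ w-dyck _ ps (trans (cong (toWord ∘ headOrLeaf) parsed) spells)
    (trans (colourWords-toColours _ _ _) (trans (cong (colours ∘ headOrLeaf) parsed) cols))

coloured↔ternary : ∀ n → ColouredDyckPath n ↔ TernaryOfSize n
coloured↔ternary n = mk↔ₛ′ (fromColoured n) (toColoured n) (fromColoured-toColoured n) (toColoured-fromColoured n)

theorem1 : (n : ℕ) → ColouredDyckPath n ⤖ NCTree (suc n)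
theorem1 n = ↔⇒⤖ (↔-trans (coloured↔ternary n) (ternary↔nctree n))
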